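{- Let $H$ be a $K_5$-free graph and let $\{A_1,\dots,A_p\}$ be a greedy partition of $H$ of size $p$. Let $A=(|A_1|,\dots,|A_p|)$, which is an $(|V(H)|,p)$-greedy sequence. Then $\mathcal{CC}_3(H)\le f(A)$.
   Context: A 3-clique cover of a graph $H$ is a collection of cliques of $H$ such that every triangle of $H$ is a subgraph of some clique in the collection; $\mathcal{CC}_3(H)$ is the minimum size of a 3-clique cover. A greedy partition of $H$ of size $p$ is a partition of $V(H)$ into disjoint sets $A_1,\dots,A_p$ such that for each $i$, $A_i$ is a clique of maximum size in $H[V(H)\setminus(A_1\cup\dots\cup A_{i-1})]$. An $(m,p)$-greedy sequence is a sequence $A=(a_1,\dots,a_p)$ with $a_i\in\{1,2,3,4\}$ for all $i$, $a_1\ge a_2\ge\dots\ge a_p$, and $\sum_{i=1}^p a_i=m$. Set $a=|\{i:a_i=4\}|$, $b=|\{i:a_i\ge 3\}|$, $c=|\{i:a_i\ge 2\}|$. The value of $A$ is $f(A)=S_1(A)+S_2(A)+S_3(A)$, where $S_1(A)=b$, $S_2(A)=mb+a^2-ab-b^2+bc-a-3b$, and $$S_3(A)=\sum_{k=3}^{b}a_k\sum_{j=2}^{k-1}(a_j-1)(j-1)+\sum_{k=b+1}^{c}a_k\Big(\sum_{j=2}^{b}(a_j-1)(j-1)+\sum_{j=b+1}^{k-1}(a_j-1)b\Big)+\sum_{k=c+1}^{p}\Big(\sum_{j=2}^{b}(a_j-1)(j-1)+\sum_{j=b+1}^{c}(a_j-1)b\Big),$$ with empty sums equal to $0$. -}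

module Defs where

open import Data.Nat as ℕ using (ℕ; zero; suc)
open import Data.Integer as ℤ using (ℤ; +_; _+_; _-_; _*_)
open import Data.Bool using (Bool; true; false)
open import Data.Fin as Fin using (Fin; toℕ)
open import Data.Fin.Subset using (Subset; _∈_; _∉_; _⊆_; ∣_∣; Nonempty)
open import Data.List using (List)
open import Data.List.Relation.Unary.All using (All)
open import Data.List.Relation.Unary.Any using (Any)
open import Data.Product using (Σ; ∃; _×_)
open import Data.Empty using (⊥)
open import Relation.Binary.PropositionalEquality using (_≡_; _≢_)
open import Relation.Nullary.Decidable using (does)
open import Function using (_∘_)

record Graph (n : ℕ) : Set where
  field
    adj    : Fin n → Fin n → Bool
    sym    : ∀ x y → adj x y ≡ adj y x
    irrefl : ∀ x → adj x x ≡ false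
open Graph public

module _ {n : ℕ} (H : Graph n) where

  IsClique : Subset n → Set
  IsClique S = ∀ x y → x ∈ S → y ∈ S → x ≢ y → adj H x y ≡ true

  K5Free : Set
  K5Free = ∀ (S : Subset n) → IsClique S → ∣ S ∣ ≡ 5 → ⊥

  -- a triangle x y z of H (distinctness follows from irreflexivity)
  IsTriangle : Fin n → Fin n → Fin n → Set
  IsTriangle x y z = adj H x y ≡ true × adj H y z ≡ true × adj H x z ≡ true

  Is3CliqueCover : List (Subset n) → Set
  Is3CliqueCover 𝒞 =
    All IsClique 𝒞 ×
    (∀ x y z → IsTriangle x y z → Any (λ C → x ∈ C × y ∈ C × z ∈ C) 𝒞)

  InRemaining : ∀ {p} → (Fin p → Subset n) → Fin p → Subset n → Set
  InRemaining A i T = ∀ x → x ∈ T → ∀ j → j Fin.< i → x ∉ A j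

  IsGreedyPartition : ∀ {p} → (Fin p → Subset n) → Set
  IsGreedyPartition {p} A =
    (∀ i → Nonempty (A i)) ×
    (∀ i j x → x ∈ A i → x ∈ A j → i ≡ j) ×
    (∀ x → ∃ λ i → x ∈ A i) ×
    (∀ i → InRemaining A i (A i) × IsClique (A i) ×
           (∀ T → InRemaining A i T → IsClique T → ∣ T ∣ ℕ.≤ ∣ A i ∣))

-- 1-indexed access: at s i = a_i for 1 ≤ i ≤ p, and 0 otherwise
at : ∀ {p} → (Fin p → ℕ) → ℕ → ℕ
at {zero}  s _             = 0
at {suc p} s zero          = 0
at {suc p} s (suc zero)    = s Fin.zero
at {suc p} s (suc (suc i)) = at {p} (s ∘ Fin.suc) (suc i)

-- Σ_{j=lo}^{hi} g j  (empty, i.e. 0, when hi < lo)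
sumFromTo : ℕ → ℕ → (ℕ → ℤ) → ℤ
sumFromTo lo hi g = go (suc hi ℕ.∸ lo)
  where
  go : ℕ → ℤ
  go zero    = + 0
  go (suc k) = go k + g (lo ℕ.+ k)

ind : Bool → ℤ
ind true  = + 1
ind false = + 0

module _ {p : ℕ} (s : Fin p → ℕ) where

  private
    aₖ : ℕ → ℤ
    aₖ k = + at s k

  m′ a′ b′ c′ : ℤ
  m′ = sumFromTo 1 p aₖ
  a′ = sumFromTo 1 p (λ i → ind (does (at s i ℕ.≟ 4)))
  b′ = sumFromTo 1 p (λ i → ind (does (3 ℕ.≤? at s i)))
  c′ = sumFromTo 1 p (λ i → ind (does (2 ℕ.≤? at s i)))

  countA countB countC : ℕ
  countA = ℤ.∣ a′ ∣
  countB = ℤ.∣ b′ ∣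
  countC = ℤ.∣ c′ ∣

  S₁ : ℤ
  S₁ = b′

  S₂ : ℤ
  S₂ = m′ * b′ + a′ * a′ - a′ * b′ - b′ * b′ + b′ * c′ - a′ - + 3 * b′

  S₃ : ℤ
  S₃ =
    sumFromTo 3 b (λ k → aₖ k *
      sumFromTo 2 (k ℕ.∸ 1) (λ j → (aₖ j - + 1) * + (j ℕ.∸ 1)))
    + sumFromTo (suc b) c (λ k → aₖ k *
      (sumFromTo 2 b (λ j → (aₖ j - + 1) * + (j ℕ.∸ 1))
       + sumFromTo (suc b) (k ℕ.∸ 1) (λ j → (aₖ j - + 1) * + b)))
    + sumFromTo (suc c) p (λ k →
       sumFromTo 2 b (λ j → (aₖ j - + 1) * + (j ℕ.∸ 1))
       + sumFromTo (suc b) c (λ j → (aₖ j - + 1) * + b))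
    where
    b = countB
    c = countC

  f : ℤ
  f = S₁ + S₂ + S₃

{-# OPTIONS --safe #-}
module Submission where

-- Let the vertices of a triangle x y z lie in the greedy blocks i ≤ j ≤ k.  The triangle is charged
-- to block k and covered by A_k itself (i = j = k); by z with its neighbours in A_j (i = j < k); for
-- i < j = k, by one of one, three or four cliques per earlier block i, according as |A_k| = 2, 3 or 4
-- (K₅-freeness caps the block sizes at 4); and for i < j < k by the edge yz extended by its common
-- neighbours in A_i.  Greediness does the counting: a block at or before the blocks of all three
-- vertices of a triangle has size at least 3, so i ranges over the first b blocks, and a later vertex
-- has at most |A_j| − 1 neighbours in A_j.  Summed over k these counts are exactly f(A): S₁ + S₂
-- telescopes block by block, and S₃ = Σ_k a_k · Σ_{j<k} (a_j − 1)·min(j − 1, b).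

module TriangleCover where
  open import Defs hiding (sym)
  open import Data.Bool using (Bool; true; false)
  open import Data.Nat using (ℕ; zero; suc; _≤_; _<_; z≤n; s≤s; _≤?_; _≟_; _∸_; _⊓_)
  open import Data.Nat.Properties
    using (≤-refl; ≤-trans; ≤-reflexive; ≤-antisym; ≤-total; ≤-pred; <⇒≤; <⇒≱; ≰⇒>; n≤1+n;
           m≤n⇒m≤1+n; m≤n⇒m<n∨m≡n; suc[m]≤n⇒m≤pred[n])
  open import Data.Fin as Fin using (Fin; toℕ)
  open import Data.Fin.Subset
    using (Subset; ⊥; Nonempty; _∈_; _∉_; _⊆_; ∣_∣; ⁅_⁆; _∪_; _∩_; _─_; inside; outside)
  open import Data.Fin.Subset.Properties
    using (_∈?_; p⊆q⇒∣p∣≤∣q∣; p⊂q⇒∣p∣<∣q∣; p⊆p∪q; q⊆p∪q; x∈p∪q⁺; x∈p∪q⁻; x∈p∩q⁺; x∈p∩q⁻;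
           x∈⁅x⁆; x∈⁅y⁆⇒x≡y)
  open import Data.Integer using (ℤ; +_)
  open import Data.Vec using ([]; _∷_; here; there)
  open import Data.Product using (_×_; _,_; proj₁; proj₂; ∃)
  open import Data.Sum using (_⊎_; inj₁; inj₂; [_,_]′)
  open import Function using (_∘_)
  open import Relation.Nullary using (yes; no; does; contradiction)
  open import Relation.Nullary.Decidable using (dec-true)
  open import Relation.Binary.PropositionalEquality
    using (_≡_; _≢_; refl; sym; trans; cong; cong₂; subst; subst₂; module ≡-Reasoning)

  indicator : Bool → ℕ
  indicator true  = 1
  indicator false = 0

  ind≡+indicator : ∀ b → ind b ≡ + indicator b
  ind≡+indicator true  = refl
  ind≡+indicator false = refl

  module NatSums where
    open import Data.Nat using (_+_; _*_)
    open import Data.Nat.Properties using (+-mono-≤; *-zeroʳ)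
    open import Data.Nat.Tactic.RingSolver using (solve-∀)

    ∑ : ℕ → (ℕ → ℕ) → ℕ
    ∑ zero    g = 0
    ∑ (suc r) g = ∑ r g + g (suc r)

    ∑-cong : ∀ r {g h} → (∀ {i} → 1 ≤ i → i ≤ r → g i ≡ h i) → ∑ r g ≡ ∑ r h
    ∑-cong zero    eq = refl
    ∑-cong (suc r) eq = cong₂ _+_ (∑-cong r (λ 1≤i i≤r → eq 1≤i (m≤n⇒m≤1+n i≤r))) (eq (s≤s z≤n) ≤-refl)

    ∑-mono : ∀ r {g h} → (∀ {i} → 1 ≤ i → i ≤ r → g i ≤ h i) → ∑ r g ≤ ∑ r h
    ∑-mono zero    le = z≤n
    ∑-mono (suc r) le = +-mono-≤ (∑-mono r (λ 1≤i i≤r → le 1≤i (m≤n⇒m≤1+n i≤r))) (le (s≤s z≤n) ≤-refl)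

    ∑-const : ∀ r c → ∑ r (λ _ → c) ≡ c * r
    ∑-const zero    c = sym (*-zeroʳ c)
    ∑-const (suc r) c = trans (cong (_+ c) (∑-const r c)) (*-suc′ c r)
      where
      *-suc′ : ∀ c r → c * r + c ≡ c * suc r
      *-suc′ = solve-∀

    ∑-distrib-+ : ∀ r g h → ∑ r (λ i → g i + h i) ≡ ∑ r g + ∑ r h
    ∑-distrib-+ zero    g h = refl
    ∑-distrib-+ (suc r) g h =
      trans (cong (_+ (g (suc r) + h (suc r))) (∑-distrib-+ r g h))
            (interchange (∑ r g) (∑ r h) (g (suc r)) (h (suc r)))
      where
      interchange : ∀ a b x y → a + b + (x + y) ≡ a + x + (b + y)
      interchange = solve-∀

  module IntervalSums where
    open import Data.Nat.Properties using (_<?_; ≮⇒≥; m≤n⇒m∸n≡0; +-∸-assoc; m+[n∸m]≡n)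
    open import Data.Integer using (_+_)
    open import Data.Integer.Properties using (+-identityˡ; +-identityʳ; +-assoc)
    open NatSums using (∑)
    open ≡-Reasoning

    sumFromTo-empty : ∀ l {hi} (g : ℕ → ℤ) → hi ≤ l → sumFromTo (suc l) hi g ≡ + 0
    sumFromTo-empty l g hi≤l rewrite m≤n⇒m∸n≡0 hi≤l = refl

    sumFromTo-snoc : ∀ l {h} (g : ℕ → ℤ) → l ≤ h →
                     sumFromTo (suc l) (suc h) g ≡ sumFromTo (suc l) h g + g (suc h)
    sumFromTo-snoc l g l≤h rewrite +-∸-assoc 1 l≤h | m+[n∸m]≡n l≤h = refl

    sumFromTo-cong : ∀ l hi {g h : ℕ → ℤ} → (∀ {k} → l < k → k ≤ hi → g k ≡ h k) →
                     sumFromTo (suc l) hi g ≡ sumFromTo (suc l) hi h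
    sumFromTo-cong l zero {g} {h} _ = trans (sumFromTo-empty l g z≤n) (sym (sumFromTo-empty l h z≤n))
    sumFromTo-cong l (suc hi) {g} {h} eq with l ≤? hi
    ... | yes l≤hi = begin
      sumFromTo (suc l) (suc hi) g         ≡⟨ sumFromTo-snoc l g l≤hi ⟩
      sumFromTo (suc l) hi g + g (suc hi)  ≡⟨ cong₂ _+_ (sumFromTo-cong l hi (λ l<k k≤hi → eq l<k (m≤n⇒m≤1+n k≤hi)))
                                                        (eq (s≤s l≤hi) ≤-refl) ⟩
      sumFromTo (suc l) hi h + h (suc hi)  ≡⟨ sym (sumFromTo-snoc l h l≤hi) ⟩
      sumFromTo (suc l) (suc hi) h         ∎
    ... | no l≰hi = trans (sumFromTo-empty l g (≰⇒> l≰hi)) (sym (sumFromTo-empty l h (≰⇒> l≰hi)))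

    sumFromTo-split : ∀ l m hi (g : ℕ → ℤ) → l ≤ m → m ≤ hi →
                      sumFromTo (suc l) hi g ≡ sumFromTo (suc l) m g + sumFromTo (suc m) hi g
    sumFromTo-split l m hi g l≤m m≤hi with m≤n⇒m<n∨m≡n m≤hi
    ... | inj₂ refl =
      sym (trans (cong (_+_ (sumFromTo (suc l) m g)) (sumFromTo-empty m g ≤-refl)) (+-identityʳ _))
    sumFromTo-split l m (suc hi) g l≤m m≤hi | inj₁ (s≤s m≤hi′) = begin
      sumFromTo (suc l) (suc hi) g
        ≡⟨ sumFromTo-snoc l g (≤-trans l≤m m≤hi′) ⟩
      sumFromTo (suc l) hi g + g (suc hi)
        ≡⟨ cong (_+ g (suc hi)) (sumFromTo-split l m hi g l≤m m≤hi′) ⟩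
      sumFromTo (suc l) m g + sumFromTo (suc m) hi g + g (suc hi)
        ≡⟨ +-assoc (sumFromTo (suc l) m g) _ _ ⟩
      sumFromTo (suc l) m g + (sumFromTo (suc m) hi g + g (suc hi))
        ≡⟨ cong (_+_ (sumFromTo (suc l) m g)) (sym (sumFromTo-snoc m g m≤hi′)) ⟩
      sumFromTo (suc l) m g + sumFromTo (suc m) (suc hi) g ∎

    sumFromTo-dropZero : ∀ l hi {g : ℕ → ℤ} → g (suc l) ≡ + 0 →
                         sumFromTo (suc l) hi g ≡ sumFromTo (suc (suc l)) hi g
    sumFromTo-dropZero l hi {g} g≡0 with l <? hi
    ... | yes l<hi = begin
      sumFromTo (suc l) hi g                                     ≡⟨ sumFromTo-split l (suc l) hi g (n≤1+n l) l<hi ⟩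
      sumFromTo (suc l) (suc l) g + sumFromTo (suc (suc l)) hi g ≡⟨ cong (_+ sumFromTo (suc (suc l)) hi g) single ⟩
      + 0 + sumFromTo (suc (suc l)) hi g                         ≡⟨ +-identityˡ _ ⟩
      sumFromTo (suc (suc l)) hi g                               ∎
      where
      single : sumFromTo (suc l) (suc l) g ≡ + 0
      single = trans (sumFromTo-snoc l g ≤-refl) (cong₂ _+_ (sumFromTo-empty l g ≤-refl) g≡0)
    ... | no l≮hi =
      trans (sumFromTo-empty l g (≮⇒≥ l≮hi)) (sym (sumFromTo-empty (suc l) g (m≤n⇒m≤1+n (≮⇒≥ l≮hi))))

    sumFromTo-+ : ∀ r (g : ℕ → ℕ) → sumFromTo 1 r (λ i → + g i) ≡ + ∑ r g
    sumFromTo-+ zero    g = refl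
    sumFromTo-+ (suc r) g =
      trans (sumFromTo-snoc 0 {r} (λ i → + g i) z≤n) (cong (_+ + g (suc r)) (sumFromTo-+ r g))

    sumFromTo-ind : ∀ r (q : ℕ → Bool) → sumFromTo 1 r (λ i → ind (q i)) ≡ + ∑ r (λ i → indicator (q i))
    sumFromTo-ind r q =
      trans (sumFromTo-cong 0 r (λ {k} _ _ → ind≡+indicator (q k))) (sumFromTo-+ r (λ i → indicator (q i)))

  module Quadratic where
    open import Data.Integer using (_+_; _-_; _*_)
    open import Data.Integer.Tactic.RingSolver using (solve-∀)

    S₁₂ : ℤ → ℤ → ℤ → ℤ → ℤ
    S₁₂ m a b c = b + (m * b + a * a - a * b - b * b + b * c - a - + 3 * b)

    -- S₁₂ after eliminating m = r + a + b + c, which holds when every entry lies in {1, 2, 3, 4}.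
    Q : ℤ → ℤ → ℤ → ℤ → ℤ
    Q r a b c = r * b + + 2 * b * c + a * a - a - + 2 * b

    -- The ring solver does not unfold definitions, so these identities spell out S₁₂ and Q.
    S₁₂≡Q : ∀ r a b c → b + ((r + a + b + c) * b + a * a - a * b - b * b + b * c - a - + 3 * b)
                        ≡ r * b + + 2 * b * c + a * a - a - + 2 * b
    S₁₂≡Q = solve-∀

    Q-step₁ : ∀ r a b c → (+ 1 + r) * b + + 2 * b * c + a * a - a - + 2 * b
                          ≡ r * b + + 2 * b * c + a * a - a - + 2 * b + (+ 0 + + 1 * b)
    Q-step₁ = solve-∀

    Q-step₂ : ∀ r a b → (+ 1 + r) * b + + 2 * b * (+ 1 + r) + a * a - a - + 2 * b
                        ≡ r * b + + 2 * b * r + a * a - a - + 2 * b + (+ 0 + + 3 * b)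
    Q-step₂ = solve-∀

    Q-step₃ : ∀ r a → (+ 1 + r) * (+ 1 + r) + + 2 * (+ 1 + r) * (+ 1 + r) + a * a - a - + 2 * (+ 1 + r)
                      ≡ r * r + + 2 * r * r + a * a - a - + 2 * r + (+ 1 + + 6 * r)
    Q-step₃ = solve-∀

    Q-step₄ : ∀ r → (+ 1 + r) * (+ 1 + r) + + 2 * (+ 1 + r) * (+ 1 + r) + (+ 1 + r) * (+ 1 + r) - (+ 1 + r)
                    - + 2 * (+ 1 + r)
                    ≡ r * r + + 2 * r * r + r * r - r - + 2 * r + (+ 1 + + 8 * r)
    Q-step₄ = solve-∀

  module GreedySequence {p : ℕ} (s : Fin p → ℕ)
      (bounded  : ∀ {k} → 1 ≤ k → k ≤ p → 1 ≤ at s k × at s k ≤ 4)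
      (antitone : ∀ {i j} → 1 ≤ i → i ≤ j → j ≤ p → at s j ≤ at s i) where

    open NatSums

    σ : ℕ → ℕ
    σ = at s

    module Counting where
      open import Data.Nat using (_+_; _*_)
      open import Data.Nat.Properties using (+-comm; +-identityʳ; +-mono-≤; m≤m+n)
      open import Data.Nat.Tactic.RingSolver using (solve-∀)
      open ≡-Reasoning

      count : (ℕ → Bool) → ℕ → ℕ
      count q r = ∑ r (λ i → indicator (q (σ i)))

      isFour : ℕ → Bool
      isFour t = does (t ≟ 4)

      atLeast : ℕ → ℕ → Bool
      atLeast d t = does (d ≤? t)

      prefixA prefixB prefixC : ℕ → ℕ
      prefixA = count isFour
      prefixB = count (atLeast 3)
      prefixC = count (atLeast 2)

      b c : ℕ
      b = prefixB p
      c = prefixC p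

      count-≤ : ∀ q r → count q r ≤ r
      count-≤ q zero    = z≤n
      count-≤ q (suc r) with q (σ (suc r))
      ... | true  = subst (count q r + 1 ≤_) (+-comm r 1) (+-mono-≤ (count-≤ q r) ≤-refl)
      ... | false = subst (_≤ suc r) (sym (+-identityʳ _)) (m≤n⇒m≤1+n (count-≤ q r))

      count-mono : ∀ q {r r′} → r ≤ r′ → count q r ≤ count q r′
      count-mono q r≤r′ with m≤n⇒m<n∨m≡n r≤r′
      ... | inj₂ refl = ≤-refl
      count-mono q {r′ = suc r′} _ | inj₁ (s≤s r≤r′) = ≤-trans (count-mono q r≤r′) (m≤m+n _ _)

      count-full : ∀ q {r} → (∀ {i} → 1 ≤ i → i ≤ r → q (σ i) ≡ true) → count q r ≡ r
      count-full q {zero}  all = refl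
      count-full q {suc r} all rewrite all (s≤s z≤n) ≤-refl
                                     | count-full q (λ 1≤i i≤r → all 1≤i (m≤n⇒m≤1+n i≤r)) = +-comm r 1

      count-unchanged : ∀ q r → q (σ (suc r)) ≡ false → count q (suc r) ≡ count q r
      count-unchanged q r eq rewrite eq = +-identityʳ _

      atLeast-full : ∀ d {k r} → k ≤ r → r ≤ p → d ≤ σ r → count (atLeast d) k ≡ k
      atLeast-full d k≤r r≤p d≤σr = count-full (atLeast d)
        (λ 1≤i i≤k → dec-true (d ≤? _) (≤-trans d≤σr (antitone 1≤i (≤-trans i≤k k≤r) r≤p)))

      isFour-full : ∀ {k r} → k ≤ r → r ≤ p → 4 ≤ σ r → prefixA k ≡ k
      isFour-full k≤r r≤p 4≤σr = count-full isFour (λ 1≤i i≤k → dec-true (_ ≟ 4)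
        (≤-antisym (proj₂ (bounded 1≤i (≤-trans (≤-trans i≤k k≤r) r≤p)))
                   (≤-trans 4≤σr (antitone 1≤i (≤-trans i≤k k≤r) r≤p))))

      ≤-count-atLeast : ∀ d {i r} → 1 ≤ i → i ≤ r → r ≤ p → d ≤ σ i → i ≤ count (atLeast d) r
      ≤-count-atLeast d 1≤i i≤r r≤p d≤σi =
        ≤-trans (≤-reflexive (sym (atLeast-full d ≤-refl (≤-trans i≤r r≤p) d≤σi))) (count-mono (atLeast d) i≤r)

      size-decomposition : ∀ {t} → 1 ≤ t → t ≤ 4 →
                           t ≡ 1 + indicator (isFour t) + indicator (atLeast 3 t) + indicator (atLeast 2 t)
      size-decomposition {1} _ _ = refl
      size-decomposition {2} _ _ = refl
      size-decomposition {3} _ _ = refl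
      size-decomposition {4} _ _ = refl
      size-decomposition {suc (suc (suc (suc (suc _))))} _ (s≤s (s≤s (s≤s (s≤s ()))))

      ∑σ≡r+A+B+C : ∀ {r} → r ≤ p → ∑ r σ ≡ r + prefixA r + prefixB r + prefixC r
      ∑σ≡r+A+B+C {zero}  _   = refl
      ∑σ≡r+A+B+C {suc r} r<p = begin
        ∑ r σ + σ (suc r)
          ≡⟨ cong₂ _+_ (∑σ≡r+A+B+C (≤-trans (n≤1+n r) r<p))
                       (size-decomposition (proj₁ (bounded (s≤s z≤n) r<p)) (proj₂ (bounded (s≤s z≤n) r<p))) ⟩
        r + prefixA r + prefixB r + prefixC r + (1 + x + y + z)
          ≡⟨ regroup r (prefixA r) (prefixB r) (prefixC r) x y z ⟩
        suc r + prefixA (suc r) + prefixB (suc r) + prefixC (suc r) ∎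
        where
        x y z : ℕ
        x = indicator (isFour (σ (suc r)))
        y = indicator (atLeast 3 (σ (suc r)))
        z = indicator (atLeast 2 (σ (suc r)))
        regroup : ∀ r a b c x y z → r + a + b + c + (1 + x + y + z) ≡ 1 + r + (a + x) + (b + y) + (c + z)
        regroup = solve-∀

      prefixB≤prefixC : ∀ r → prefixB r ≤ prefixC r
      prefixB≤prefixC r = ∑-mono r (λ {i} _ _ → indicator-mono (σ i))
        where
        indicator-mono : ∀ t → indicator (atLeast 3 t) ≤ indicator (atLeast 2 t)
        indicator-mono 0 = z≤n
        indicator-mono 1 = z≤n
        indicator-mono 2 = z≤n
        indicator-mono (suc (suc (suc t))) = ≤-refl

      σ≡1-beyond-c : ∀ {k} → c < k → k ≤ p → σ k ≡ 1
      σ≡1-beyond-c {k} c<k k≤p with 2 ≤? σ k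
      ... | yes 2≤σk = contradiction (≤-count-atLeast 2 (≤-trans (s≤s z≤n) c<k) k≤p ≤-refl 2≤σk) (<⇒≱ c<k)
      ... | no  2≰σk = ≤-antisym (≤-pred (≰⇒> 2≰σk)) (proj₁ (bounded (≤-trans (s≤s z≤n) c<k) k≤p))

      -- innerSum r = Σ_{j=1}^{r} (a_j − 1)·min(j − 1, b), the common shape of the inner sums of S₃.
      innerTerm : ℕ → ℕ
      innerTerm j = (σ j ∸ 1) * ((j ∸ 1) ⊓ b)

      innerSum : ℕ → ℕ
      innerSum r = ∑ r innerTerm

      innerSum-beyond-c : ∀ {h} → c ≤ h → h ≤ p → innerSum h ≡ innerSum c
      innerSum-beyond-c c≤h h≤p with m≤n⇒m<n∨m≡n c≤h
      ... | inj₂ refl = refl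
      innerSum-beyond-c {suc h} _ h<p | inj₁ (s≤s c≤h) = begin
        innerSum h + (σ (suc h) ∸ 1) * (h ⊓ b)
          ≡⟨ cong₂ _+_ (innerSum-beyond-c c≤h (≤-trans (n≤1+n h) h<p))
                       (cong (λ t → (t ∸ 1) * (h ⊓ b)) (σ≡1-beyond-c (s≤s c≤h) h<p)) ⟩
        innerSum c + 0 ≡⟨ +-identityʳ _ ⟩
        innerSum c     ∎

      -- Cliques charged to block k, per earlier block of size at least 3, by the triangles with
      -- two vertices in a block k of size t: A_k extended (t = 2), A_k minus one of its three
      -- vertices extended (t = 3), or the stars into A_k of the at most four vertices of the
      -- earlier block (t = 4).
      perEarlierBlock : ℕ → ℕ
      perEarlierBlock 2 = 1
      perEarlierBlock 3 = 3
      perEarlierBlock 4 = 4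
      perEarlierBlock _ = 0

      baseIncrement : ℕ → ℕ → ℕ
      baseIncrement t B = indicator (atLeast 3 t) + (t + perEarlierBlock t) * B

      baseIncrementAt : ℕ → ℕ
      baseIncrementAt k = baseIncrement (σ k) (prefixB (k ∸ 1))

      increment : ℕ → ℕ
      increment k = baseIncrementAt k + σ k * innerSum (k ∸ 1)

    module Value where
      import Data.Nat as ℕ
      import Data.Nat.Properties as ℕ
      import Data.Integer as ℤ
      open import Data.Nat.Properties using (m∸n≤m; m≤n⇒m⊓n≡m; m≥n⇒m⊓n≡n; *-identityˡ)
      open import Data.Integer using (_+_; _-_; _*_)
      open import Data.Integer.Properties using (pos-*; m-n≡m⊖n; ⊖-≥; *-zeroʳ)
      open Counting
      open IntervalSums
      open Quadratic
      open ≡-Reasoning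

      prefixQ : ℕ → ℤ
      prefixQ r = Q (+ r) (+ prefixA r) (+ prefixB r) (+ prefixC r)

      prefixQ≡ : ∀ r {a b c} → prefixA r ≡ a → prefixB r ≡ b → prefixC r ≡ c → prefixQ r ≡ Q (+ r) (+ a) (+ b) (+ c)
      prefixQ≡ r refl refl refl = refl

      +baseIncrementAt : ∀ {r t B} → σ (suc r) ≡ t → prefixB r ≡ B →
                         + baseIncrementAt (suc r) ≡ + indicator (atLeast 3 t) + + (t ℕ.+ perEarlierBlock t) * + B
      +baseIncrementAt {r} refl refl =
        cong (_+_ (+ indicator (atLeast 3 (σ (suc r))))) (pos-* (σ (suc r) ℕ.+ perEarlierBlock (σ (suc r))) (prefixB r))

      prefixQ-step₁ : ∀ {r} → σ (suc r) ≡ 1 → prefixQ (suc r) ≡ prefixQ r + + baseIncrementAt (suc r)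
      prefixQ-step₁ {r} eq = begin
        prefixQ (suc r)
          ≡⟨ prefixQ≡ (suc r) (same isFour refl) (same (atLeast 3) refl) (same (atLeast 2) refl) ⟩
        Q (+ suc r) (+ A) (+ B) (+ C)     ≡⟨ Q-step₁ (+ r) (+ A) (+ B) (+ C) ⟩
        prefixQ r + (+ 0 + + 1 * + B)     ≡⟨ cong (_+_ (prefixQ r)) (sym (+baseIncrementAt eq refl)) ⟩
        prefixQ r + + baseIncrementAt (suc r) ∎
        where
        A B C : ℕ
        A = prefixA r
        B = prefixB r
        C = prefixC r
        same : ∀ q → q 1 ≡ false → count q (suc r) ≡ count q r
        same q q1 = count-unchanged q r (trans (cong q eq) q1)

      prefixQ-step₂ : ∀ {r} → suc r ≤ p → σ (suc r) ≡ 2 → prefixQ (suc r) ≡ prefixQ r + + baseIncrementAt (suc r)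
      prefixQ-step₂ {r} r<p eq = begin
        prefixQ (suc r)                   ≡⟨ prefixQ≡ (suc r) (same isFour refl) (same (atLeast 3) refl) (C≡ ≤-refl) ⟩
        Q (+ suc r) (+ A) (+ B) (+ suc r) ≡⟨ Q-step₂ (+ r) (+ A) (+ B) ⟩
        Q (+ r) (+ A) (+ B) (+ r) + (+ 0 + + 3 * + B)
          ≡⟨ cong₂ _+_ (sym (prefixQ≡ r refl refl (C≡ (n≤1+n r)))) (sym (+baseIncrementAt eq refl)) ⟩
        prefixQ r + + baseIncrementAt (suc r) ∎
        where
        A B : ℕ
        A = prefixA r
        B = prefixB r
        same : ∀ q → q 2 ≡ false → count q (suc r) ≡ count q r
        same q q2 = count-unchanged q r (trans (cong q eq) q2)
        C≡ : ∀ {k} → k ≤ suc r → prefixC k ≡ k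
        C≡ k≤ = atLeast-full 2 k≤ r<p (≤-reflexive (sym eq))

      prefixQ-step₃ : ∀ {r} → suc r ≤ p → σ (suc r) ≡ 3 → prefixQ (suc r) ≡ prefixQ r + + baseIncrementAt (suc r)
      prefixQ-step₃ {r} r<p eq = begin
        prefixQ (suc r)                       ≡⟨ prefixQ≡ (suc r) same (B≡ ≤-refl) (C≡ ≤-refl) ⟩
        Q (+ suc r) (+ A) (+ suc r) (+ suc r) ≡⟨ Q-step₃ (+ r) (+ A) ⟩
        Q (+ r) (+ A) (+ r) (+ r) + (+ 1 + + 6 * + r)
          ≡⟨ cong₂ _+_ (sym (prefixQ≡ r refl (B≡ (n≤1+n r)) (C≡ (n≤1+n r))))
                       (sym (+baseIncrementAt eq (B≡ (n≤1+n r)))) ⟩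
        prefixQ r + + baseIncrementAt (suc r) ∎
        where
        A : ℕ
        A = prefixA r
        same : prefixA (suc r) ≡ prefixA r
        same = count-unchanged isFour r (cong isFour eq)
        B≡ : ∀ {k} → k ≤ suc r → prefixB k ≡ k
        B≡ k≤ = atLeast-full 3 k≤ r<p (≤-reflexive (sym eq))
        C≡ : ∀ {k} → k ≤ suc r → prefixC k ≡ k
        C≡ k≤ = atLeast-full 2 k≤ r<p (≤-trans (n≤1+n 2) (≤-reflexive (sym eq)))

      prefixQ-step₄ : ∀ {r} → suc r ≤ p → σ (suc r) ≡ 4 → prefixQ (suc r) ≡ prefixQ r + + baseIncrementAt (suc r)
      prefixQ-step₄ {r} r<p eq = begin
        prefixQ (suc r)                           ≡⟨ prefixQ≡ (suc r) (A≡ ≤-refl) (B≡ ≤-refl) (C≡ ≤-refl) ⟩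
        Q (+ suc r) (+ suc r) (+ suc r) (+ suc r) ≡⟨ Q-step₄ (+ r) ⟩
        Q (+ r) (+ r) (+ r) (+ r) + (+ 1 + + 8 * + r)
          ≡⟨ cong₂ _+_ (sym (prefixQ≡ r (A≡ (n≤1+n r)) (B≡ (n≤1+n r)) (C≡ (n≤1+n r))))
                       (sym (+baseIncrementAt eq (B≡ (n≤1+n r)))) ⟩
        prefixQ r + + baseIncrementAt (suc r) ∎
        where
        4≤σ : 4 ≤ σ (suc r)
        4≤σ = ≤-reflexive (sym eq)
        A≡ : ∀ {k} → k ≤ suc r → prefixA k ≡ k
        A≡ k≤ = isFour-full k≤ r<p 4≤σ
        B≡ : ∀ {k} → k ≤ suc r → prefixB k ≡ k
        B≡ k≤ = atLeast-full 3 k≤ r<p (≤-trans (n≤1+n 3) 4≤σ)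
        C≡ : ∀ {k} → k ≤ suc r → prefixC k ≡ k
        C≡ k≤ = atLeast-full 2 k≤ r<p (≤-trans (≤-trans (n≤1+n 2) (n≤1+n 3)) 4≤σ)

      prefixQ-step : ∀ {r} → suc r ≤ p → prefixQ (suc r) ≡ prefixQ r + + baseIncrementAt (suc r)
      prefixQ-step {r} r<p = by-size (σ (suc r)) refl
        where
        by-size : ∀ t → σ (suc r) ≡ t → prefixQ (suc r) ≡ prefixQ r + + baseIncrementAt (suc r)
        by-size 1 eq = prefixQ-step₁ eq
        by-size 2 eq = prefixQ-step₂ r<p eq
        by-size 3 eq = prefixQ-step₃ r<p eq
        by-size 4 eq = prefixQ-step₄ r<p eq
        by-size 0 eq = contradiction (subst (1 ≤_) eq (proj₁ (bounded (s≤s z≤n) r<p))) λ ()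
        by-size (suc (suc (suc (suc (suc _))))) eq =
          contradiction (subst (_≤ 4) eq (proj₂ (bounded (s≤s z≤n) r<p))) λ { (s≤s (s≤s (s≤s (s≤s ())))) }

      prefixQ≡∑baseIncrementAt : ∀ {r} → r ≤ p → prefixQ r ≡ + ∑ r baseIncrementAt
      prefixQ≡∑baseIncrementAt {zero}  _   = refl
      prefixQ≡∑baseIncrementAt {suc r} r<p =
        trans (prefixQ-step r<p) (cong (_+ + baseIncrementAt (suc r)) (prefixQ≡∑baseIncrementAt (≤-trans (n≤1+n r) r<p)))

      S₁+S₂≡prefixQ : S₁ s + S₂ s ≡ prefixQ p
      S₁+S₂≡prefixQ = begin
        S₁₂ (m′ s) (a′ s) (b′ s) (c′ s)
          ≡⟨ cong₂ (λ m a → S₁₂ m a (b′ s) (c′ s)) m≡ (sumFromTo-ind p (λ i → isFour (σ i))) ⟩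
        S₁₂ (+ (p ℕ.+ A ℕ.+ B ℕ.+ C)) (+ A) (b′ s) (c′ s)
          ≡⟨ cong₂ (S₁₂ (+ (p ℕ.+ A ℕ.+ B ℕ.+ C)) (+ A))
                   (sumFromTo-ind p (λ i → atLeast 3 (σ i))) (sumFromTo-ind p (λ i → atLeast 2 (σ i))) ⟩
        S₁₂ (+ (p ℕ.+ A ℕ.+ B ℕ.+ C)) (+ A) (+ B) (+ C)
          ≡⟨ S₁₂≡Q (+ p) (+ A) (+ B) (+ C) ⟩
        prefixQ p ∎
        where
        A B C : ℕ
        A = prefixA p
        B = prefixB p
        C = prefixC p
        m≡ : m′ s ≡ + (p ℕ.+ A ℕ.+ B ℕ.+ C)
        m≡ = trans (sumFromTo-+ p σ) (cong +_ (∑σ≡r+A+B+C ≤-refl))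

      b≤p : b ≤ p
      b≤p = count-≤ (atLeast 3) p

      c≤p : c ≤ p
      c≤p = count-≤ (atLeast 2) p

      b≤c : b ≤ c
      b≤c = prefixB≤prefixC p

      +σ-1≡+[σ∸1] : ∀ {j} → 1 ≤ j → j ≤ p → + σ j - + 1 ≡ + (σ j ∸ 1)
      +σ-1≡+[σ∸1] {j} 1≤j j≤p = trans (m-n≡m⊖n (σ j) 1) (⊖-≥ (proj₁ (bounded 1≤j j≤p)))

      lowTerm highTerm : ℕ → ℤ
      lowTerm  j = (+ σ j - + 1) * + (j ∸ 1)
      highTerm j = (+ σ j - + 1) * + b

      lowTerm≡innerTerm : ∀ {j} → 1 ≤ j → j ≤ p → j ∸ 1 ≤ b → lowTerm j ≡ + innerTerm j
      lowTerm≡innerTerm {j} 1≤j j≤p j-1≤b = begin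
        (+ σ j - + 1) * + (j ∸ 1)  ≡⟨ cong (_* + (j ∸ 1)) (+σ-1≡+[σ∸1] 1≤j j≤p) ⟩
        + (σ j ∸ 1) * + (j ∸ 1)    ≡⟨ sym (pos-* (σ j ∸ 1) (j ∸ 1)) ⟩
        + ((σ j ∸ 1) ℕ.* (j ∸ 1))  ≡⟨ cong (λ x → + ((σ j ∸ 1) ℕ.* x)) (sym (m≤n⇒m⊓n≡m j-1≤b)) ⟩
        + innerTerm j              ∎

      highTerm≡innerTerm : ∀ {j} → 1 ≤ j → j ≤ p → b ≤ j ∸ 1 → highTerm j ≡ + innerTerm j
      highTerm≡innerTerm {j} 1≤j j≤p b≤j-1 = begin
        (+ σ j - + 1) * + b        ≡⟨ cong (_* + b) (+σ-1≡+[σ∸1] 1≤j j≤p) ⟩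
        + (σ j ∸ 1) * + b          ≡⟨ sym (pos-* (σ j ∸ 1) b) ⟩
        + ((σ j ∸ 1) ℕ.* b)        ≡⟨ cong (λ x → + ((σ j ∸ 1) ℕ.* x)) (sym (m≥n⇒m⊓n≡n b≤j-1)) ⟩
        + innerTerm j              ∎

      ∑lowTerm≡innerSum : ∀ {h} → h ≤ b → sumFromTo 2 h lowTerm ≡ + innerSum h
      ∑lowTerm≡innerSum {h} h≤b = begin
        sumFromTo 2 h lowTerm                ≡⟨ sym (sumFromTo-dropZero 0 h (*-zeroʳ (+ σ 1 - + 1))) ⟩
        sumFromTo 1 h lowTerm                ≡⟨ sumFromTo-cong 0 h (λ 1≤j j≤h →
                                                  lowTerm≡innerTerm 1≤j (≤-trans j≤h (≤-trans h≤b b≤p))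
                                                                    (≤-trans (m∸n≤m _ 1) (≤-trans j≤h h≤b))) ⟩
        sumFromTo 1 h (λ j → + innerTerm j)  ≡⟨ sumFromTo-+ h innerTerm ⟩
        + innerSum h                         ∎

      ∑lowTerm+∑highTerm≡innerSum : ∀ {h} → b ≤ h → h ≤ p →
                                    sumFromTo 2 b lowTerm + sumFromTo (suc b) h highTerm ≡ + innerSum h
      ∑lowTerm+∑highTerm≡innerSum {h} b≤h h≤p = begin
        sumFromTo 2 b lowTerm + sumFromTo (suc b) h highTerm
          ≡⟨ cong₂ _+_ (trans (∑lowTerm≡innerSum ≤-refl) (sym (sumFromTo-+ b innerTerm)))
                       (sumFromTo-cong b h (λ b<j j≤h → highTerm≡innerTerm (≤-trans (s≤s z≤n) b<j)
                                                          (≤-trans j≤h h≤p) (suc[m]≤n⇒m≤pred[n] b<j))) ⟩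
        sumFromTo 1 b (λ j → + innerTerm j) + sumFromTo (suc b) h (λ j → + innerTerm j)
          ≡⟨ sym (sumFromTo-split 0 b h _ z≤n b≤h) ⟩
        sumFromTo 1 h (λ j → + innerTerm j)
          ≡⟨ sumFromTo-+ h innerTerm ⟩
        + innerSum h ∎

      -- S₃ s unfolds to S₃-shape (countB s) (countC s).
      S₃-shape : ℕ → ℕ → ℤ
      S₃-shape B C =
        sumFromTo 3 B (λ k → + σ k * sumFromTo 2 (k ∸ 1) (λ j → (+ σ j - + 1) * + (j ∸ 1)))
        + sumFromTo (suc B) C (λ k → + σ k *
            (sumFromTo 2 B (λ j → (+ σ j - + 1) * + (j ∸ 1)) + sumFromTo (suc B) (k ∸ 1) (λ j → (+ σ j - + 1) * + B)))
        + sumFromTo (suc C) p (λ k →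
            sumFromTo 2 B (λ j → (+ σ j - + 1) * + (j ∸ 1)) + sumFromTo (suc B) C (λ j → (+ σ j - + 1) * + B))

      S₃-term : ℕ → ℤ
      S₃-term k = + (σ k ℕ.* innerSum (k ∸ 1))

      S₃≡∑S₃-term : S₃ s ≡ sumFromTo 1 p S₃-term
      S₃≡∑S₃-term = begin
        S₃-shape (countB s) (countC s)
          ≡⟨ cong₂ S₃-shape (cong ℤ.∣_∣ (sumFromTo-ind p (λ i → atLeast 3 (σ i))))
                            (cong ℤ.∣_∣ (sumFromTo-ind p (λ i → atLeast 2 (σ i)))) ⟩
        S₃-shape b c
          ≡⟨ cong₂ _+_ (cong₂ _+_ up-to-b from-b-to-c) beyond-c ⟩
        sumFromTo 1 b S₃-term + sumFromTo (suc b) c S₃-term + sumFromTo (suc c) p S₃-term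
          ≡⟨ cong (_+ sumFromTo (suc c) p S₃-term) (sym (sumFromTo-split 0 b c S₃-term z≤n b≤c)) ⟩
        sumFromTo 1 c S₃-term + sumFromTo (suc c) p S₃-term
          ≡⟨ sym (sumFromTo-split 0 c p S₃-term z≤n c≤p) ⟩
        sumFromTo 1 p S₃-term ∎
        where
        ≡S₃-term : ∀ {k} x → x ≡ + innerSum (k ∸ 1) → + σ k * x ≡ S₃-term k
        ≡S₃-term {k} x refl = sym (pos-* (σ k) (innerSum (k ∸ 1)))

        up-to-b : sumFromTo 3 b (λ k → + σ k * sumFromTo 2 (k ∸ 1) lowTerm) ≡ sumFromTo 1 b S₃-term
        up-to-b = begin
          sumFromTo 3 b (λ k → + σ k * sumFromTo 2 (k ∸ 1) lowTerm)
            ≡⟨ sumFromTo-cong 2 b (λ {k} _ k≤b → ≡S₃-term _ (∑lowTerm≡innerSum (≤-trans (m∸n≤m k 1) k≤b))) ⟩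
          sumFromTo 3 b S₃-term
            ≡⟨ sym (sumFromTo-dropZero 1 b (cong +_ (trans (cong (σ 2 ℕ.*_) (ℕ.*-zeroʳ (σ 1 ∸ 1))) (ℕ.*-zeroʳ (σ 2))))) ⟩
          sumFromTo 2 b S₃-term
            ≡⟨ sym (sumFromTo-dropZero 0 b (cong +_ (ℕ.*-zeroʳ (σ 1)))) ⟩
          sumFromTo 1 b S₃-term ∎

        from-b-to-c : sumFromTo (suc b) c (λ k → + σ k * (sumFromTo 2 b lowTerm + sumFromTo (suc b) (k ∸ 1) highTerm))
                      ≡ sumFromTo (suc b) c S₃-term
        from-b-to-c = sumFromTo-cong b c (λ {k} b<k k≤c → ≡S₃-term _
          (∑lowTerm+∑highTerm≡innerSum (suc[m]≤n⇒m≤pred[n] b<k) (≤-trans (m∸n≤m k 1) (≤-trans k≤c c≤p))))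

        beyond-c : sumFromTo (suc c) p (λ _ → sumFromTo 2 b lowTerm + sumFromTo (suc b) c highTerm)
                   ≡ sumFromTo (suc c) p S₃-term
        beyond-c = sumFromTo-cong c p (λ {k} c<k k≤p → begin
          sumFromTo 2 b lowTerm + sumFromTo (suc b) c highTerm
            ≡⟨ ∑lowTerm+∑highTerm≡innerSum b≤c c≤p ⟩
          + innerSum c
            ≡⟨ cong +_ (sym (innerSum-beyond-c (suc[m]≤n⇒m≤pred[n] c<k) (≤-trans (m∸n≤m k 1) k≤p))) ⟩
          + innerSum (k ∸ 1)
            ≡⟨ cong +_ (sym (trans (cong (ℕ._* innerSum (k ∸ 1)) (σ≡1-beyond-c c<k k≤p)) (*-identityˡ _))) ⟩
          S₃-term k ∎)

      f≡∑increment : f s ≡ + ∑ p increment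
      f≡∑increment = begin
        S₁ s + S₂ s + S₃ s
          ≡⟨ cong₂ _+_ (trans S₁+S₂≡prefixQ (prefixQ≡∑baseIncrementAt ≤-refl))
                       (trans S₃≡∑S₃-term (sumFromTo-+ p (λ k → σ k ℕ.* innerSum (k ∸ 1)))) ⟩
        + (∑ p baseIncrementAt ℕ.+ ∑ p (λ k → σ k ℕ.* innerSum (k ∸ 1)))
          ≡⟨ cong +_ (sym (∑-distrib-+ p baseIncrementAt (λ k → σ k ℕ.* innerSum (k ∸ 1)))) ⟩
        + ∑ p increment ∎

  module SubsetCardinality where
    open import Data.Nat using (_+_)
    open import Data.Nat.Properties using (+-suc; +-monoʳ-≤)
    open import Data.Fin.Properties using (any?)
    open import Data.Fin.Subset.Properties using (⊥⊆; ∣⊥∣≡0; out⊆; in⊆in; ∣⁅x⁆∣≡1)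
    open import Relation.Nullary.Decidable using (_×-dec_; ¬?)

    private
      variable
        n : ℕ

    ∣p∪q∣≤∣p∣+∣q∣ : ∀ (p q : Subset n) → ∣ p ∪ q ∣ ≤ ∣ p ∣ + ∣ q ∣
    ∣p∪q∣≤∣p∣+∣q∣ []            []            = z≤n
    ∣p∪q∣≤∣p∣+∣q∣ (outside ∷ p) (outside ∷ q) = ∣p∪q∣≤∣p∣+∣q∣ p q
    ∣p∪q∣≤∣p∣+∣q∣ (outside ∷ p) (inside  ∷ q) =
      ≤-trans (s≤s (∣p∪q∣≤∣p∣+∣q∣ p q)) (≤-reflexive (sym (+-suc ∣ p ∣ ∣ q ∣)))
    ∣p∪q∣≤∣p∣+∣q∣ (inside  ∷ p) (outside ∷ q) = s≤s (∣p∪q∣≤∣p∣+∣q∣ p q)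
    ∣p∪q∣≤∣p∣+∣q∣ (inside  ∷ p) (inside  ∷ q) =
      s≤s (≤-trans (∣p∪q∣≤∣p∣+∣q∣ p q) (+-monoʳ-≤ ∣ p ∣ (n≤1+n ∣ q ∣)))

    x∉p⇒∣p∣<∣⁅x⁆∪p∣ : ∀ {x} {p : Subset n} → x ∉ p → ∣ p ∣ < ∣ ⁅ x ⁆ ∪ p ∣
    x∉p⇒∣p∣<∣⁅x⁆∪p∣ {x = x} {p} x∉p = p⊂q⇒∣p∣<∣q∣ (q⊆p∪q ⁅ x ⁆ p , x , x∈p∪q⁺ (inj₁ (x∈⁅x⁆ x)) , x∉p)

    p⊆q∧∣q∣≤∣p∣⇒q⊆p : ∀ {p q : Subset n} → p ⊆ q → ∣ q ∣ ≤ ∣ p ∣ → q ⊆ p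
    p⊆q∧∣q∣≤∣p∣⇒q⊆p {p = p} p⊆q ∣q∣≤∣p∣ {x} x∈q with x ∈? p
    ... | yes x∈p = x∈p
    ... | no  x∉p = contradiction ∣q∣≤∣p∣ (<⇒≱ (p⊂q⇒∣p∣<∣q∣ (p⊆q , x , x∈q , x∉p)))

    ∣p∣<∣q∣⇒∃x∈q∧x∉p : ∀ {p q : Subset n} → ∣ p ∣ < ∣ q ∣ → ∃ λ x → x ∈ q × x ∉ p
    ∣p∣<∣q∣⇒∃x∈q∧x∉p {p = p} {q} ∣p∣<∣q∣ with any? (λ x → (x ∈? q) ×-dec ¬? (x ∈? p))
    ... | yes witness = witness
    ... | no  none    = contradiction (p⊆q⇒∣p∣≤∣q∣ q⊆p) (<⇒≱ ∣p∣<∣q∣)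
      where
      q⊆p : q ⊆ p
      q⊆p {x} x∈q with x ∈? p
      ... | yes x∈p = x∈p
      ... | no  x∉p = contradiction (x , x∈q , x∉p) none

    x∈q⇒x∉p─q : ∀ {p q : Subset n} {x} → x ∈ q → x ∉ p ─ q
    x∈q⇒x∉p─q {p = _ ∷ p} {inside ∷ q} here ()
    x∈q⇒x∉p─q {p = _ ∷ p} {_ ∷ q} (there x∈q) (there x∈p─q) = x∈q⇒x∉p─q x∈q x∈p─q

    ⊆-ofSize : ∀ m (S : Subset n) → m ≤ ∣ S ∣ → ∃ λ T → T ⊆ S × ∣ T ∣ ≡ m
    ⊆-ofSize {n} zero S _ = ⊥ , ⊥⊆ , ∣⊥∣≡0 n
    ⊆-ofSize (suc m) (outside ∷ S) m<∣S∣ with ⊆-ofSize (suc m) S m<∣S∣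
    ... | T , T⊆S , ∣T∣≡ = outside ∷ T , out⊆ T⊆S , ∣T∣≡
    ⊆-ofSize (suc m) (inside  ∷ S) (s≤s m≤∣S∣) with ⊆-ofSize m S m≤∣S∣
    ... | T , T⊆S , ∣T∣≡ = inside ∷ T , in⊆in T⊆S , cong suc ∣T∣≡

    ∪⊆ : ∀ {p q r : Subset n} → p ⊆ r → q ⊆ r → p ∪ q ⊆ r
    ∪⊆ {p = p} {q} p⊆r q⊆r x∈ = [ p⊆r , q⊆r ]′ (x∈p∪q⁻ p q x∈)

    ⁅⁆⊆ : ∀ {x} {S : Subset n} → x ∈ S → ⁅ x ⁆ ⊆ S
    ⁅⁆⊆ {x = x} {S} x∈S y∈ = subst (_∈ S) (sym (x∈⁅y⁆⇒x≡y x y∈)) x∈S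

    pair : Fin n → Fin n → Subset n
    pair x y = ⁅ x ⁆ ∪ ⁅ y ⁆

    ∈pair⁻ : ∀ {x y z : Fin n} → z ∈ pair x y → z ≡ x ⊎ z ≡ y
    ∈pair⁻ {x = x} {y} z∈ with x∈p∪q⁻ ⁅ x ⁆ ⁅ y ⁆ z∈
    ... | inj₁ z∈x = inj₁ (x∈⁅y⁆⇒x≡y x z∈x)
    ... | inj₂ z∈y = inj₂ (x∈⁅y⁆⇒x≡y y z∈y)

    x∈pair : ∀ (x y : Fin n) → x ∈ pair x y
    x∈pair x y = p⊆p∪q ⁅ y ⁆ (x∈⁅x⁆ x)

    y∈pair : ∀ (x y : Fin n) → y ∈ pair x y
    y∈pair x y = q⊆p∪q ⁅ x ⁆ ⁅ y ⁆ (x∈⁅x⁆ y)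

    pair⊆ : ∀ {x y} {S : Subset n} → x ∈ S → y ∈ S → pair x y ⊆ S
    pair⊆ x∈S y∈S = ∪⊆ (⁅⁆⊆ x∈S) (⁅⁆⊆ y∈S)

    ∣pair∣≤2 : ∀ (x y : Fin n) → ∣ pair x y ∣ ≤ 2
    ∣pair∣≤2 x y = subst₂ (λ a b → ∣ pair x y ∣ ≤ a + b) (∣⁅x⁆∣≡1 x) (∣⁅x⁆∣≡1 y) (∣p∪q∣≤∣p∣+∣q∣ ⁅ x ⁆ ⁅ y ⁆)

    2≤∣pair∣ : ∀ {x y : Fin n} → x ≢ y → 2 ≤ ∣ pair x y ∣
    2≤∣pair∣ {x = x} {y} x≢y =
      subst (λ k → suc k ≤ ∣ pair x y ∣) (∣⁅x⁆∣≡1 y) (x∉p⇒∣p∣<∣⁅x⁆∪p∣ (λ x∈y → x≢y (x∈⁅y⁆⇒x≡y y x∈y)))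

    3≤∣⁅x⁆∪pair∣ : ∀ {x y z : Fin n} → x ≢ y → x ≢ z → y ≢ z → 3 ≤ ∣ ⁅ x ⁆ ∪ pair y z ∣
    3≤∣⁅x⁆∪pair∣ {x = x} {y} {z} x≢y x≢z y≢z = ≤-trans (s≤s (2≤∣pair∣ y≢z)) (x∉p⇒∣p∣<∣⁅x⁆∪p∣ x∉yz)
      where
      x∉yz : x ∉ pair y z
      x∉yz x∈ = [ x≢y , x≢z ]′ (∈pair⁻ x∈)

  module ListComprehension where
    open import Data.Nat using (_+_; _*_)
    open import Data.Nat.Properties using (+-mono-≤; *-identityˡ)
    open import Data.List using (List; []; _++_; length; [_])
    open import Data.List.Properties using (length-++)
    open import Data.List.Membership.Propositional using () renaming (_∈_ to _∈ᴸ_)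
    open import Data.List.Membership.Propositional.Properties using (∈-++⁺ˡ; ∈-++⁺ʳ)
    open NatSums

    private
      variable
        n : ℕ
        X : Set

    concatFor : ℕ → (ℕ → List X) → List X
    concatFor zero    f = []
    concatFor (suc m) f = concatFor m f ++ f (suc m)

    concatOver : Subset n → (Fin n → List X) → List X
    concatOver []            f = []
    concatOver (outside ∷ S) f = concatOver S (f ∘ Fin.suc)
    concatOver (inside  ∷ S) f = f Fin.zero ++ concatOver S (f ∘ Fin.suc)

    ∈-concatFor : ∀ {m} (f : ℕ → List X) {i c} → 1 ≤ i → i ≤ m → c ∈ᴸ f i → c ∈ᴸ concatFor m f
    ∈-concatFor {m = zero}  f (s≤s _) ()
    ∈-concatFor {m = suc m} f 1≤i i≤m c∈ with m≤n⇒m<n∨m≡n i≤m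
    ... | inj₂ refl       = ∈-++⁺ʳ (concatFor m f) c∈
    ... | inj₁ (s≤s i≤m′) = ∈-++⁺ˡ (∈-concatFor f 1≤i i≤m′ c∈)

    ∈-concatOver : ∀ {S : Subset n} (f : Fin n → List X) {x c} → x ∈ S → c ∈ᴸ f x →
                   c ∈ᴸ concatOver S f
    ∈-concatOver {S = inside  ∷ S} f here       c∈ = ∈-++⁺ˡ c∈
    ∈-concatOver {S = inside  ∷ S} f (there x∈) c∈ =
      ∈-++⁺ʳ (f Fin.zero) (∈-concatOver (f ∘ Fin.suc) x∈ c∈)
    ∈-concatOver {S = outside ∷ S} f (there x∈) c∈ = ∈-concatOver (f ∘ Fin.suc) x∈ c∈

    length-concatFor : ∀ m (f : ℕ → List X) → length (concatFor m f) ≡ ∑ m (λ i → length (f i))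
    length-concatFor zero    f = refl
    length-concatFor (suc m) f =
      trans (length-++ (concatFor m f)) (cong (_+ length (f (suc m))) (length-concatFor m f))

    length-concatFor≤ : ∀ m (f : ℕ → List X) {M} → (∀ {i} → 1 ≤ i → i ≤ m → length (f i) ≤ M) →
                        length (concatFor m f) ≤ M * m
    length-concatFor≤ m f {M} bound =
      ≤-trans (≤-reflexive (length-concatFor m f)) (≤-trans (∑-mono m bound) (≤-reflexive (∑-const m M)))

    length-concatFor-[] : ∀ m (f : ℕ → X) → length (concatFor m (λ i → [ f i ])) ≡ m
    length-concatFor-[] m f =
      trans (length-concatFor m (λ i → [ f i ])) (trans (∑-const m 1) (*-identityˡ m))

    length-concatOver-[] : ∀ (S : Subset n) (f : Fin n → X) →
                           length (concatOver S (λ x → [ f x ])) ≡ ∣ S ∣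
    length-concatOver-[] []            f = refl
    length-concatOver-[] (outside ∷ S) f = length-concatOver-[] S (f ∘ Fin.suc)
    length-concatOver-[] (inside  ∷ S) f = cong suc (length-concatOver-[] S (f ∘ Fin.suc))

    length-concatOver : ∀ (S : Subset n) (f : Fin n → List X) {M} →
                        (∀ {x} → x ∈ S → length (f x) ≤ M) → length (concatOver S f) ≤ ∣ S ∣ * M
    length-concatOver []            f bound = z≤n
    length-concatOver (outside ∷ S) f bound = length-concatOver S (f ∘ Fin.suc) (λ x∈ → bound (there x∈))
    length-concatOver (inside  ∷ S) f bound = subst (_≤ _) (sym (length-++ (f Fin.zero)))
      (+-mono-≤ (bound here) (length-concatOver S (f ∘ Fin.suc) (λ x∈ → bound (there x∈))))

  module Cliques {n : ℕ} (H : Graph n) where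
    open import Data.Bool.Properties as Bool using ()
    open import Data.Fin.Properties using (all?)
    open import Data.Fin.Subset.Properties using (_⊆?_; p∩q⊆p)
    open import Data.Vec using (tabulate)
    open import Data.Vec.Properties using (lookup∘tabulate; []=⇒lookup; lookup⇒[]=)
    open import Relation.Nullary using (Dec)
    open import Relation.Nullary.Decidable using (_→-dec_; ¬?)
    open SubsetCardinality using (⁅⁆⊆; pair; pair⊆)

    adj-sym : ∀ {x y} → adj H x y ≡ true → adj H y x ≡ true
    adj-sym {x} {y} xy = trans (Graph.sym H y x) xy

    adj⇒≢ : ∀ {x y} → adj H x y ≡ true → x ≢ y
    adj⇒≢ {x} xy refl with trans (sym xy) (irrefl H x)
    ... | ()

    N : Fin n → Subset n
    N x = tabulate (adj H x)

    ∈N⁺ : ∀ {x y} → adj H x y ≡ true → y ∈ N x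
    ∈N⁺ {x} {y} xy = lookup⇒[]= y (N x) (trans (lookup∘tabulate (adj H x) y) xy)

    ∈N⁻ : ∀ {x y} → y ∈ N x → adj H x y ≡ true
    ∈N⁻ {x} {y} y∈ = trans (sym (lookup∘tabulate (adj H x) y)) ([]=⇒lookup y∈)

    common : Subset n → Subset n
    common E = tabulate (λ x → does (E ⊆? N x))

    ∈common⁺ : ∀ {E x} → E ⊆ N x → x ∈ common E
    ∈common⁺ {E} {x} E⊆ =
      lookup⇒[]= x (common E) (trans (lookup∘tabulate (λ x → does (E ⊆? N x)) x) (dec-true (E ⊆? N x) E⊆))

    ∈common⁻ : ∀ {E x} → x ∈ common E → E ⊆ N x
    ∈common⁻ {E} {x} x∈ with E ⊆? N x | trans (sym (lookup∘tabulate (λ x → does (E ⊆? N x)) x)) ([]=⇒lookup x∈)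
    ... | yes E⊆ | _  = E⊆
    ... | no  _  | ()

    isClique? : ∀ C → Dec (IsClique H C)
    isClique? C = all? λ x → all? λ y →
      (x ∈? C) →-dec (y ∈? C) →-dec ¬? (x Fin.≟ y) →-dec (adj H x y Bool.≟ true)

    IsClique-⊆ : ∀ {S T} → T ⊆ S → IsClique H S → IsClique H T
    IsClique-⊆ T⊆S S-clique x y x∈ y∈ = S-clique x y (T⊆S x∈) (T⊆S y∈)

    ⁅⁆-clique : ∀ x → IsClique H ⁅ x ⁆
    ⁅⁆-clique x u v u∈ v∈ u≢v = contradiction (trans (x∈⁅y⁆⇒x≡y x u∈) (sym (x∈⁅y⁆⇒x≡y x v∈))) u≢v

    ∪-clique : ∀ {S T} → IsClique H S → IsClique H T →
               (∀ {x y} → x ∈ S → y ∈ T → x ≢ y → adj H x y ≡ true) → IsClique H (S ∪ T)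
    ∪-clique {S} {T} S-clique T-clique across x y x∈ y∈ x≢y with x∈p∪q⁻ S T x∈ | x∈p∪q⁻ S T y∈
    ... | inj₁ x∈S | inj₁ y∈S = S-clique x y x∈S y∈S x≢y
    ... | inj₁ x∈S | inj₂ y∈T = across x∈S y∈T x≢y
    ... | inj₂ x∈T | inj₁ y∈S = adj-sym (across y∈S x∈T (x≢y ∘ sym))
    ... | inj₂ x∈T | inj₂ y∈T = T-clique x y x∈T y∈T x≢y

    ⁅⁆⊆N : ∀ {x y} → adj H x y ≡ true → ⁅ y ⁆ ⊆ N x
    ⁅⁆⊆N xy = ⁅⁆⊆ (∈N⁺ xy)

    pair⊆N : ∀ {x y z} → adj H x y ≡ true → adj H x z ≡ true → pair y z ⊆ N x
    pair⊆N xy xz = pair⊆ (∈N⁺ xy) (∈N⁺ xz)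

    pair-clique : ∀ {x y} → adj H x y ≡ true → IsClique H (pair x y)
    pair-clique {x} xy = ∪-clique (⁅⁆-clique x) (⁅⁆-clique _)
      (λ u∈ v∈ _ → subst (λ u → adj H u _ ≡ true) (sym (x∈⁅y⁆⇒x≡y x u∈)) (∈N⁻ (⁅⁆⊆N xy v∈)))

    extend : Subset n → Subset n → Subset n
    extend E S = E ∪ (S ∩ common E)

    extend-clique : ∀ {E S} → IsClique H E → IsClique H S → IsClique H (extend E S)
    extend-clique {E} {S} E-clique S-clique = ∪-clique E-clique (IsClique-⊆ (p∩q⊆p S (common E)) S-clique)
      (λ x∈E y∈ _ → adj-sym (∈N⁻ (∈common⁻ (proj₂ (x∈p∩q⁻ S (common E) y∈)) x∈E)))

    ⊆-extend : ∀ {E} S → E ⊆ extend E S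
    ⊆-extend {E} S = p⊆p∪q (S ∩ common E)

    ∈extend⁺ : ∀ {E S x} → x ∈ S → E ⊆ N x → x ∈ extend E S
    ∈extend⁺ {E} x∈S E⊆ = q⊆p∪q E _ (x∈p∩q⁺ (x∈S , ∈common⁺ E⊆))

    ∈extend⁻ : ∀ {E S x} → x ∈ extend E S → x ∈ E ⊎ x ∈ S
    ∈extend⁻ {E} {S} x∈ with x∈p∪q⁻ E (S ∩ common E) x∈
    ... | inj₁ x∈E  = inj₁ x∈E
    ... | inj₂ x∈S∩ = inj₂ (proj₁ (x∈p∩q⁻ S (common E) x∈S∩))

  module GreedyPartition {n p : ℕ} (H : Graph n) (A : Fin p → Subset n) (greedy : IsGreedyPartition H A) where
    open import Data.Empty using (⊥-elim)
    open import Data.Fin.Properties using (toℕ<n; toℕ-fromℕ<)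
    open import Data.Fin.Subset.Properties using (∉⊥; ∣⊥∣≡0; x∈p⇒∣p-x∣<∣p∣)
    open SubsetCardinality
    open Cliques H

    -- 1-indexed like `at`: blockAt A k is A_k for 1 ≤ k ≤ p and empty otherwise.
    blockAt : ∀ {m} → (Fin m → Subset n) → ℕ → Subset n
    blockAt {zero}  _ _             = ⊥
    blockAt {suc m} _ zero          = ⊥
    blockAt {suc m} A (suc zero)    = A Fin.zero
    blockAt {suc m} A (suc (suc k)) = blockAt (A ∘ Fin.suc) (suc k)

    ∣blockAt∣≡at : ∀ {m} (A : Fin m → Subset n) k → ∣ blockAt A k ∣ ≡ at (λ i → ∣ A i ∣) k
    ∣blockAt∣≡at {zero}  A k             = ∣⊥∣≡0 n
    ∣blockAt∣≡at {suc m} A zero          = ∣⊥∣≡0 n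
    ∣blockAt∣≡at {suc m} A (suc zero)    = refl
    ∣blockAt∣≡at {suc m} A (suc (suc k)) = ∣blockAt∣≡at (A ∘ Fin.suc) (suc k)

    blockAt-toℕ : ∀ {m} (A : Fin m → Subset n) i → blockAt A (suc (toℕ i)) ≡ A i
    blockAt-toℕ {suc m} A Fin.zero    = refl
    blockAt-toℕ {suc m} A (Fin.suc i) = blockAt-toℕ (A ∘ Fin.suc) i

    ∈blockAt⁻ : ∀ {m} (A : Fin m → Subset n) k {x} → x ∈ blockAt A k → ∃ λ i → k ≡ suc (toℕ i) × x ∈ A i
    ∈blockAt⁻ {zero}  A k             x∈ = contradiction x∈ ∉⊥
    ∈blockAt⁻ {suc m} A zero          x∈ = contradiction x∈ ∉⊥
    ∈blockAt⁻ {suc m} A (suc zero)    x∈ = Fin.zero , refl , x∈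
    ∈blockAt⁻ {suc m} A (suc (suc k)) x∈ with ∈blockAt⁻ (A ∘ Fin.suc) (suc k) x∈
    ... | i , refl , x∈A = Fin.suc i , refl , x∈A

    nonempty : ∀ i → Nonempty (A i)
    nonempty = proj₁ greedy

    disjoint : ∀ i j x → x ∈ A i → x ∈ A j → i ≡ j
    disjoint = proj₁ (proj₂ greedy)

    covering : ∀ x → ∃ λ i → x ∈ A i
    covering = proj₁ (proj₂ (proj₂ greedy))

    maximum : ∀ i → InRemaining H A i (A i) × IsClique H (A i) ×
                    (∀ T → InRemaining H A i T → IsClique H T → ∣ T ∣ ≤ ∣ A i ∣)
    maximum = proj₂ (proj₂ (proj₂ greedy))

    B : ℕ → Subset n
    B = blockAt A

    σ : ℕ → ℕ
    σ = at (λ i → ∣ A i ∣)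

    block : Fin n → ℕ
    block x = suc (toℕ (proj₁ (covering x)))

    ∈-block : ∀ x → x ∈ B (block x)
    ∈-block x = subst (x ∈_) (sym (blockAt-toℕ A (proj₁ (covering x)))) (proj₂ (covering x))

    block-unique : ∀ {k x} → x ∈ B k → k ≡ block x
    block-unique {k} {x} x∈ with ∈blockAt⁻ A k x∈
    ... | i , refl , x∈A = cong (suc ∘ toℕ) (disjoint i (proj₁ (covering x)) x x∈A (proj₂ (covering x)))

    block≤p : ∀ x → block x ≤ p
    block≤p x = toℕ<n (proj₁ (covering x))

    ≤block : ∀ {j k w} → j ≤ k → w ∈ B k → j ≤ block w
    ≤block j≤k w∈ = ≤-trans j≤k (≤-reflexive (block-unique w∈))

    ∣B∣≡σ : ∀ k → ∣ B k ∣ ≡ σ k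
    ∣B∣≡σ = ∣blockAt∣≡at A

    B-clique : ∀ k → IsClique H (B k)
    B-clique k x y x∈ y∈ with ∈blockAt⁻ A k x∈
    ... | i , refl , x∈A = proj₁ (proj₂ (maximum i)) x y x∈A (subst (y ∈_) (blockAt-toℕ A i) y∈)

    B-fromℕ< : ∀ {k} (k<p : k < p) → B (suc k) ≡ A (Fin.fromℕ< k<p)
    B-fromℕ< k<p = trans (cong (λ j → blockAt A (suc j)) (sym (toℕ-fromℕ< k<p))) (blockAt-toℕ A _)

    B-maximum : ∀ {k} → 1 ≤ k → k ≤ p → ∀ {T} → IsClique H T → (∀ {x} → x ∈ T → k ≤ block x) → ∣ T ∣ ≤ σ k
    B-maximum {suc k} _ k<p {T} T-clique T-late =
      subst (∣ T ∣ ≤_) (sym σ≡) (proj₂ (proj₂ (maximum i)) T remaining T-clique)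
      where
      i : Fin p
      i = Fin.fromℕ< k<p
      σ≡ : σ (suc k) ≡ ∣ A i ∣
      σ≡ = trans (sym (∣B∣≡σ (suc k))) (cong ∣_∣ (B-fromℕ< k<p))
      remaining : InRemaining H A i T
      remaining x x∈T j j<i x∈Aj = <⇒≱ (subst (toℕ j <_) (toℕ-fromℕ< k<p) j<i)
        (≤-pred (subst (suc k ≤_) (cong (suc ∘ toℕ) (sym (disjoint j _ x x∈Aj (proj₂ (covering x))))) (T-late x∈T)))

    σ-antitone : ∀ {i j} → 1 ≤ i → i ≤ j → j ≤ p → σ j ≤ σ i
    σ-antitone {i} {j} 1≤i i≤j j≤p =
      subst (_≤ σ i) (∣B∣≡σ j) (B-maximum 1≤i (≤-trans i≤j j≤p) (B-clique j) (≤block i≤j))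

    σ-positive : ∀ {k} → 1 ≤ k → k ≤ p → 1 ≤ σ k
    σ-positive {suc k} _ k<p with nonempty (Fin.fromℕ< k<p)
    ... | x , x∈ = subst (1 ≤_) (∣B∣≡σ (suc k))
                     (≤-trans (s≤s z≤n) (x∈p⇒∣p-x∣<∣p∣ (subst (x ∈_) (sym (B-fromℕ< k<p)) x∈)))

    σ≤4 : K5Free H → ∀ k → σ k ≤ 4
    σ≤4 K5 k with 5 ≤? σ k
    ... | no  5≰σk = ≤-pred (≰⇒> 5≰σk)
    ... | yes 5≤σk with ⊆-ofSize 5 (B k) (subst (5 ≤_) (sym (∣B∣≡σ k)) 5≤σk)
    ...   | T , T⊆B , ∣T∣≡5 = ⊥-elim (K5 T (IsClique-⊆ T⊆B (B-clique k)) ∣T∣≡5)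

    2≤σ : ∀ {k y z} → y ∈ B k → z ∈ B k → y ≢ z → 2 ≤ σ k
    2≤σ {k} y∈ z∈ y≢z = subst (2 ≤_) (∣B∣≡σ k) (≤-trans (2≤∣pair∣ y≢z) (p⊆q⇒∣p∣≤∣q∣ (pair⊆ y∈ z∈)))

    triangle⇒3≤σ : ∀ {k x y z} → IsTriangle H x y z → 1 ≤ k → k ≤ p →
                   k ≤ block x → k ≤ block y → k ≤ block z → 3 ≤ σ k
    triangle⇒3≤σ {k} {x} {y} {z} (xy , yz , xz) 1≤k k≤p kx ky kz =
      ≤-trans (3≤∣⁅x⁆∪pair∣ (adj⇒≢ xy) (adj⇒≢ xz) (adj⇒≢ yz)) (B-maximum 1≤k k≤p T-clique T-late)
      where
      T-clique : IsClique H (⁅ x ⁆ ∪ pair y z)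
      T-clique = ∪-clique (⁅⁆-clique x) (pair-clique yz)
        (λ u∈ v∈ _ → subst (λ u → adj H u _ ≡ true) (sym (x∈⁅y⁆⇒x≡y x u∈)) (∈N⁻ (pair⊆N xy xz v∈)))
      T-late : ∀ {w} → w ∈ ⁅ x ⁆ ∪ pair y z → k ≤ block w
      T-late w∈ with x∈p∪q⁻ ⁅ x ⁆ (pair y z) w∈
      ... | inj₁ w∈x = subst (λ w → k ≤ block w) (sym (x∈⁅y⁆⇒x≡y x w∈x)) kx
      ... | inj₂ w∈yz with ∈pair⁻ w∈yz
      ...   | inj₁ refl = ky
      ...   | inj₂ refl = kz

    -- v with its neighbours in A_j is a clique among the blocks from j on, and v ∉ A_j.
    ∣B∩N∣<σ : ∀ {j v} → 1 ≤ j → j < block v → ∣ B j ∩ N v ∣ < σ j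
    ∣B∩N∣<σ {j} {v} 1≤j j<v =
      ≤-trans (p⊂q⇒∣p∣<∣q∣ (⊆E , v , ⊆-extend (B j) (x∈⁅x⁆ v) , v∉)) (B-maximum 1≤j j≤p E-clique E-late)
      where
      j≤p : j ≤ p
      j≤p = ≤-trans (<⇒≤ j<v) (block≤p v)
      E : Subset n
      E = extend ⁅ v ⁆ (B j)
      E-clique : IsClique H E
      E-clique = extend-clique (⁅⁆-clique v) (B-clique j)
      ⊆E : B j ∩ N v ⊆ E
      ⊆E y∈ with x∈p∩q⁻ (B j) (N v) y∈
      ... | y∈B , y∈N = ∈extend⁺ y∈B (⁅⁆⊆N (adj-sym (∈N⁻ y∈N)))
      v∉ : v ∉ B j ∩ N v
      v∉ v∈ = adj⇒≢ (∈N⁻ (proj₂ (x∈p∩q⁻ (B j) (N v) v∈))) refl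
      E-late : ∀ {w} → w ∈ E → j ≤ block w
      E-late w∈ with ∈extend⁻ w∈
      ... | inj₁ w∈v = subst (λ w → j ≤ block w) (sym (x∈⁅y⁆⇒x≡y v w∈v)) (<⇒≤ j<v)
      ... | inj₂ w∈B = ≤block ≤-refl w∈B

  module CliqueCover {n p : ℕ} (H : Graph n) (K5 : K5Free H) (A : Fin p → Subset n)
                     (greedy : IsGreedyPartition H A) where
    open import Data.Nat using (_+_; _*_)
    open import Data.Nat.Properties using (+-mono-≤; *-monoˡ-≤; ⊓-glb; module ≤-Reasoning)
    open import Data.Nat.Tactic.RingSolver using (solve-∀)
    open import Data.Bool using (if_then_else_)
    open import Data.Fin.Subset using (_-_)
    open import Data.Fin.Subset.Properties using (p─q⊆p; x∈p∧x≢y⇒x∈p-y)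
    open import Data.List using (List; []; _++_; length; [_])
    open import Data.List.Properties using (length-++)
    open import Data.List.Membership.Propositional using () renaming (_∈_ to _∈ᴸ_)
    open import Data.List.Membership.Propositional.Properties using (∈-++⁺ˡ; ∈-++⁺ʳ)
    open import Data.List.Relation.Unary.Any using () renaming (here to hereᴸ)
    open NatSums
    open SubsetCardinality
    open ListComprehension
    open Cliques H
    open GreedyPartition H A greedy
    open ≤-Reasoning

    sizes : Fin p → ℕ
    sizes i = ∣ A i ∣

    σ-bounded : ∀ {k} → 1 ≤ k → k ≤ p → 1 ≤ σ k × σ k ≤ 4
    σ-bounded 1≤k k≤p = σ-positive 1≤k k≤p , σ≤4 K5 _

    open GreedySequence sizes σ-bounded σ-antitone using (module Counting; module Value)
    open Counting
    open Counting public using (increment)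
    open Value public using (f≡∑increment)

    -- The cliques charged to block k = suc r, for the triangles x y z with x ∈ A_i, y ∈ A_j,
    -- z ∈ A_k and i ≤ j ≤ k: sameBlock for i = j = k, earlierPair for i = j < k, lastPair for
    -- i < j = k and spread for i < j < k.
    sameBlock : ℕ → List (Subset n)
    sameBlock k = if atLeast 3 (σ k) then [ B k ] else []

    earlierPair : ℕ → List (Subset n)
    earlierPair r = concatOver (B (suc r)) λ z → concatFor (prefixB r) λ j → [ extend ⁅ z ⁆ (B j) ]

    lastPair : ℕ → ℕ → List (Subset n)
    lastPair 2 r = concatFor (prefixB r) λ i → [ extend (B (suc r)) (B i) ]
    lastPair 3 r = concatFor (prefixB r) λ i → concatOver (B (suc r)) λ u → [ extend (B (suc r) - u) (B i) ]
    lastPair 4 r = concatFor (prefixB r) λ i → concatOver (B i) λ x → [ extend ⁅ x ⁆ (B (suc r)) ]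
    lastPair _ r = []

    spreadThrough : Fin n → ℕ → List (Subset n)
    spreadThrough z j = concatOver (B j ∩ N z) λ y → concatFor ((j ∸ 1) ⊓ b) λ i → [ extend (pair y z) (B i) ]

    spread : ℕ → List (Subset n)
    spread r = concatOver (B (suc r)) λ z → concatFor r (spreadThrough z)

    newCliques : ℕ → List (Subset n)
    newCliques zero    = []
    newCliques (suc r) = sameBlock (suc r) ++ earlierPair r ++ lastPair (σ (suc r)) r ++ spread r

    candidates : List (Subset n)
    candidates = concatFor p newCliques

    length-sameBlock : ∀ k → length (sameBlock k) ≤ indicator (atLeast 3 (σ k))
    length-sameBlock k with atLeast 3 (σ k)
    ... | true  = ≤-refl
    ... | false = ≤-refl

    length-earlierPair : ∀ r → length (earlierPair r) ≤ σ (suc r) * prefixB r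
    length-earlierPair r = subst (λ t → length (earlierPair r) ≤ t * prefixB r) (∣B∣≡σ (suc r))
      (length-concatOver (B (suc r)) _ (λ _ → ≤-reflexive (length-concatFor-[] (prefixB r) _)))

    length-lastPair : ∀ r → length (lastPair (σ (suc r)) r) ≤ perEarlierBlock (σ (suc r)) * prefixB r
    length-lastPair r = by-size (σ (suc r)) refl
      where
      by-size : ∀ t → σ (suc r) ≡ t → length (lastPair t r) ≤ perEarlierBlock t * prefixB r
      by-size 2 _  = length-concatFor≤ (prefixB r) _ (λ _ _ → ≤-refl)
      by-size 3 eq = length-concatFor≤ (prefixB r) _
        (λ _ _ → ≤-reflexive (trans (length-concatOver-[] (B (suc r)) _) (trans (∣B∣≡σ (suc r)) eq)))
      by-size 4 _  = length-concatFor≤ (prefixB r) _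
        (λ {i} _ _ → ≤-trans (≤-reflexive (trans (length-concatOver-[] (B i) _) (∣B∣≡σ i))) (σ≤4 K5 i))
      by-size 0 _ = z≤n
      by-size 1 _ = z≤n
      by-size (suc (suc (suc (suc (suc _))))) _ = z≤n

    length-spreadThrough : ∀ {z j} → 1 ≤ j → j < block z → length (spreadThrough z j) ≤ innerTerm j
    length-spreadThrough {z} {j} 1≤j j<z =
      ≤-trans (length-concatOver (B j ∩ N z) _ (λ _ → ≤-reflexive (length-concatFor-[] ((j ∸ 1) ⊓ b) _)))
              (*-monoˡ-≤ ((j ∸ 1) ⊓ b) (suc[m]≤n⇒m≤pred[n] (∣B∩N∣<σ 1≤j j<z)))

    length-spread : ∀ r → length (spread r) ≤ σ (suc r) * innerSum r
    length-spread r = subst (λ t → length (spread r) ≤ t * innerSum r) (∣B∣≡σ (suc r))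
      (length-concatOver (B (suc r)) _ λ {z} z∈ → begin
        length (concatFor r (spreadThrough z))             ≡⟨ length-concatFor r (spreadThrough z) ⟩
        ∑ r (λ j → length (spreadThrough z j))             ≤⟨ ∑-mono r (λ 1≤j j≤r → length-spreadThrough 1≤j
                                                                 (≤block (s≤s j≤r) z∈)) ⟩
        innerSum r                                         ∎)

    length-newCliques : ∀ r → length (newCliques (suc r)) ≤ increment (suc r)
    length-newCliques r = begin
      length (sameBlock (suc r) ++ earlierPair r ++ lastPair t r ++ spread r)
        ≡⟨ trans (length-++ (sameBlock (suc r))) (cong (_+_ (length (sameBlock (suc r))))
             (trans (length-++ (earlierPair r)) (cong (_+_ (length (earlierPair r))) (length-++ (lastPair t r))))) ⟩
      length (sameBlock (suc r)) + (length (earlierPair r) + (length (lastPair t r) + length (spread r)))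
        ≤⟨ +-mono-≤ (length-sameBlock (suc r))
             (+-mono-≤ (length-earlierPair r) (+-mono-≤ (length-lastPair r) (length-spread r))) ⟩
      indicator (atLeast 3 t) + (t * prefixB r + (perEarlierBlock t * prefixB r + t * innerSum r))
        ≡⟨ regroup (indicator (atLeast 3 t)) t (perEarlierBlock t) (prefixB r) (innerSum r) ⟩
      increment (suc r) ∎
      where
      t : ℕ
      t = σ (suc r)
      regroup : ∀ i t q B W → i + (t * B + (q * B + t * W)) ≡ i + (t + q) * B + t * W
      regroup = solve-∀

    length-candidates : length candidates ≤ ∑ p increment
    length-candidates = ≤-trans (≤-reflexive (length-concatFor p newCliques)) (∑-mono p per-block)
      where
      per-block : ∀ {k} → 1 ≤ k → k ≤ p → length (newCliques k) ≤ increment k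
      per-block {suc r} _ _ = length-newCliques r

    Covered : List (Subset n) → Fin n → Fin n → Fin n → Set
    Covered 𝒞 x y z = ∃ λ C → C ∈ᴸ 𝒞 × IsClique H C × x ∈ C × y ∈ C × z ∈ C

    Covered-⊆ : ∀ {𝒞 𝒟 x y z} → (∀ {C} → C ∈ᴸ 𝒞 → C ∈ᴸ 𝒟) → Covered 𝒞 x y z → Covered 𝒟 x y z
    Covered-⊆ 𝒞⊆𝒟 (C , C∈ , rest) = C , 𝒞⊆𝒟 C∈ , rest

    triangle-block≤prefixB : ∀ {r i x y z} → IsTriangle H x y z → x ∈ B i → i ≤ block y → i ≤ block z →
                             1 ≤ i → i ≤ r → r ≤ p → i ≤ prefixB r
    triangle-block≤prefixB t x∈ iy iz 1≤i i≤r r≤p =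
      ≤-count-atLeast 3 1≤i i≤r r≤p (triangle⇒3≤σ t 1≤i (≤-trans i≤r r≤p) (≤block ≤-refl x∈) iy iz)

    cover-sameBlock : ∀ {k x y z} → IsTriangle H x y z → x ∈ B k → y ∈ B k → z ∈ B k → 1 ≤ k → k ≤ p →
                      Covered (sameBlock k) x y z
    cover-sameBlock {k} t x∈ y∈ z∈ 1≤k k≤p = B k , B∈ , B-clique k , x∈ , y∈ , z∈
      where
      B∈ : B k ∈ᴸ sameBlock k
      B∈ rewrite dec-true (3 ≤? σ k) (triangle⇒3≤σ t 1≤k k≤p (≤block ≤-refl x∈) (≤block ≤-refl y∈) (≤block ≤-refl z∈))
        = hereᴸ refl

    cover-earlierPair : ∀ {r j x y z} → IsTriangle H x y z → x ∈ B j → y ∈ B j → z ∈ B (suc r) →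
                        1 ≤ j → j ≤ r → suc r ≤ p → Covered (earlierPair r) x y z
    cover-earlierPair {r} {j} {x} {y} {z} t@(xy , yz , xz) x∈ y∈ z∈ 1≤j j≤r r<p =
      C , ∈-concatOver _ z∈ (∈-concatFor _ 1≤j j≤b (hereᴸ refl)) , extend-clique (⁅⁆-clique z) (B-clique j) ,
      ∈extend⁺ x∈ (⁅⁆⊆N xz) , ∈extend⁺ y∈ (⁅⁆⊆N yz) , ⊆-extend (B j) (x∈⁅x⁆ z)
      where
      C : Subset n
      C = extend ⁅ z ⁆ (B j)
      j≤b : j ≤ prefixB r
      j≤b = triangle-block≤prefixB t x∈ (≤block ≤-refl y∈) (≤block (m≤n⇒m≤1+n j≤r) z∈) 1≤j j≤r (≤-trans (n≤1+n r) r<p)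

    cover-lastPair : ∀ {r i x y z} → IsTriangle H x y z → x ∈ B i → y ∈ B (suc r) → z ∈ B (suc r) →
                     1 ≤ i → i ≤ r → suc r ≤ p → Covered (lastPair (σ (suc r)) r) x y z
    cover-lastPair {r} {i} {x} {y} {z} t@(xy , yz , xz) x∈ y∈ z∈ 1≤i i≤r r<p = by-size (σ (suc r)) refl
      where
      k : ℕ
      k = suc r
      y≢z : y ≢ z
      y≢z = adj⇒≢ yz
      i≤b : i ≤ prefixB r
      i≤b = triangle-block≤prefixB t x∈ (≤block (m≤n⇒m≤1+n i≤r) y∈) (≤block (m≤n⇒m≤1+n i≤r) z∈)
                                   1≤i i≤r (≤-trans (n≤1+n r) r<p)
      ∣B∣≡ : ∀ {t} → σ k ≡ t → ∣ B k ∣ ≡ t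
      ∣B∣≡ eq = trans (∣B∣≡σ k) eq

      by-size : ∀ t → σ k ≡ t → Covered (lastPair t r) x y z
      by-size 2 eq = C , ∈-concatFor _ 1≤i i≤b (hereᴸ refl) , extend-clique (B-clique k) (B-clique i) ,
                     ∈extend⁺ x∈ (λ w∈ → pair⊆N xy xz (B⊆yz w∈)) , ⊆-extend (B i) y∈ , ⊆-extend (B i) z∈
        where
        C : Subset n
        C = extend (B k) (B i)
        B⊆yz : B k ⊆ pair y z
        B⊆yz = p⊆q∧∣q∣≤∣p∣⇒q⊆p (pair⊆ y∈ z∈) (subst (_≤ ∣ pair y z ∣) (sym (∣B∣≡ eq)) (2≤∣pair∣ y≢z))
      by-size 3 eq with ∣p∣<∣q∣⇒∃x∈q∧x∉p (subst (∣ pair y z ∣ <_) (sym (∣B∣≡ eq)) (s≤s (∣pair∣≤2 y z)))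
      ... | u , u∈ , u∉ = C , ∈-concatFor _ 1≤i i≤b (∈-concatOver _ u∈ (hereᴸ refl)) ,
                          extend-clique (IsClique-⊆ (p─q⊆p (B k) ⁅ u ⁆) (B-clique k)) (B-clique i) ,
                          ∈extend⁺ x∈ (λ w∈ → pair⊆N xy xz (E⊆yz w∈)) ,
                          ⊆-extend (B i) (x∈p∧x≢y⇒x∈p-y y∈ (u≢y ∘ sym)) ,
                          ⊆-extend (B i) (x∈p∧x≢y⇒x∈p-y z∈ (u≢z ∘ sym))
        where
        E C : Subset n
        E = B k - u
        C = extend E (B i)
        u≢y : u ≢ y
        u≢y refl = u∉ (x∈pair u z)
        u≢z : u ≢ z
        u≢z refl = u∉ (y∈pair y u)
        B⊆uyz : B k ⊆ ⁅ u ⁆ ∪ pair y z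
        B⊆uyz = p⊆q∧∣q∣≤∣p∣⇒q⊆p (∪⊆ (⁅⁆⊆ u∈) (pair⊆ y∈ z∈))
                  (subst (_≤ ∣ ⁅ u ⁆ ∪ pair y z ∣) (sym (∣B∣≡ eq)) (3≤∣⁅x⁆∪pair∣ u≢y u≢z y≢z))
        E⊆yz : E ⊆ pair y z
        E⊆yz {w} w∈ with x∈p∪q⁻ ⁅ u ⁆ (pair y z) (B⊆uyz (p─q⊆p (B k) ⁅ u ⁆ w∈))
        ... | inj₁ w∈u  = contradiction w∈ (x∈q⇒x∉p─q w∈u)
        ... | inj₂ w∈yz = w∈yz
      by-size 4 eq = C , ∈-concatFor _ 1≤i i≤b (∈-concatOver _ x∈ (hereᴸ refl)) ,
                     extend-clique (⁅⁆-clique x) (B-clique k) ,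
                     ⊆-extend (B k) (x∈⁅x⁆ x) , ∈extend⁺ y∈ (⁅⁆⊆N (adj-sym xy)) , ∈extend⁺ z∈ (⁅⁆⊆N (adj-sym xz))
        where
        C : Subset n
        C = extend ⁅ x ⁆ (B k)
      by-size 0 eq = contradiction (subst (2 ≤_) eq (2≤σ y∈ z∈ y≢z)) λ ()
      by-size 1 eq = contradiction (subst (2 ≤_) eq (2≤σ y∈ z∈ y≢z)) λ { (s≤s ()) }
      by-size (suc (suc (suc (suc (suc _))))) eq =
        contradiction (subst (_≤ 4) eq (σ≤4 K5 k)) λ { (s≤s (s≤s (s≤s (s≤s ())))) }

    cover-spread : ∀ {r i j x y z} → IsTriangle H x y z → x ∈ B i → y ∈ B j → z ∈ B (suc r) →
                   1 ≤ i → i < j → j ≤ r → suc r ≤ p → Covered (spread r) x y z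
    cover-spread {r} {i} {j} {x} {y} {z} t@(xy , yz , xz) x∈ y∈ z∈ 1≤i i<j j≤r r<p =
      C , C∈ , extend-clique (pair-clique yz) (B-clique i) ,
      ∈extend⁺ x∈ (pair⊆N xy xz) , ⊆-extend (B i) (x∈pair y z) , ⊆-extend (B i) (y∈pair y z)
      where
      C : Subset n
      C = extend (pair y z) (B i)
      i≤b : i ≤ (j ∸ 1) ⊓ b
      i≤b = ⊓-glb (suc[m]≤n⇒m≤pred[n] i<j)
              (triangle-block≤prefixB t x∈ (≤block (<⇒≤ i<j) y∈) (≤block (≤-trans (<⇒≤ i<j) (m≤n⇒m≤1+n j≤r)) z∈)
                                      1≤i (≤-trans (<⇒≤ i<j) (≤-trans j≤r (≤-trans (n≤1+n r) r<p))) ≤-refl)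
      C∈ : C ∈ᴸ spread r
      C∈ = ∈-concatOver _ z∈ (∈-concatFor _ (≤-trans 1≤i (<⇒≤ i<j)) j≤r
             (∈-concatOver _ (x∈p∩q⁺ (y∈ , ∈N⁺ (adj-sym yz))) (∈-concatFor _ 1≤i i≤b (hereᴸ refl))))

    covered-sorted : ∀ {x y z} → IsTriangle H x y z → block x ≤ block y → block y ≤ block z →
                     Covered candidates x y z
    covered-sorted {x} {y} {z} t bx≤by by≤bz = Covered-⊆ (∈-concatFor newCliques (s≤s z≤n) r<p) by-pattern
      where
      r : ℕ
      r = toℕ (proj₁ (covering z))
      r<p : suc r ≤ p
      r<p = block≤p z
      ∈B : ∀ {w k} → block w ≡ k → w ∈ B k
      ∈B {w} refl = ∈-block w
      𝒮 ℰ ℒ : List (Subset n)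
      𝒮 = sameBlock (suc r)
      ℰ = earlierPair r
      ℒ = lastPair (σ (suc r)) r
      by-pattern : Covered (newCliques (suc r)) x y z
      by-pattern with m≤n⇒m<n∨m≡n bx≤by | m≤n⇒m<n∨m≡n by≤bz
      ... | inj₂ i≡j | inj₂ j≡k = Covered-⊆ ∈-++⁺ˡ
        (cover-sameBlock t (∈B (trans i≡j j≡k)) (∈B j≡k) (∈-block z) (s≤s z≤n) r<p)
      ... | inj₂ i≡j | inj₁ j<k = Covered-⊆ (∈-++⁺ʳ 𝒮 ∘ ∈-++⁺ˡ)
        (cover-earlierPair t (∈B i≡j) (∈-block y) (∈-block z) (s≤s z≤n) (≤-pred j<k) r<p)
      ... | inj₁ i<j | inj₂ j≡k = Covered-⊆ (∈-++⁺ʳ 𝒮 ∘ ∈-++⁺ʳ ℰ ∘ ∈-++⁺ˡ)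
        (cover-lastPair t (∈-block x) (∈B j≡k) (∈-block z) (s≤s z≤n) (≤-pred (subst (block x <_) j≡k i<j)) r<p)
      ... | inj₁ i<j | inj₁ j<k = Covered-⊆ (∈-++⁺ʳ 𝒮 ∘ ∈-++⁺ʳ ℰ ∘ ∈-++⁺ʳ ℒ)
        (cover-spread t (∈-block x) (∈-block y) (∈-block z) (s≤s z≤n) i<j (≤-pred j<k) r<p)

    triangle-swap₁₂ : ∀ {x y z} → IsTriangle H x y z → IsTriangle H y x z
    triangle-swap₁₂ (xy , yz , xz) = adj-sym xy , xz , yz

    triangle-swap₂₃ : ∀ {x y z} → IsTriangle H x y z → IsTriangle H x z y
    triangle-swap₂₃ (xy , yz , xz) = xz , adj-sym yz , xy

    Covered-swap₁₂ : ∀ {𝒞 x y z} → Covered 𝒞 x y z → Covered 𝒞 y x z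
    Covered-swap₁₂ (C , C∈ , clique , x∈ , y∈ , z∈) = C , C∈ , clique , y∈ , x∈ , z∈

    Covered-swap₂₃ : ∀ {𝒞 x y z} → Covered 𝒞 x y z → Covered 𝒞 x z y
    Covered-swap₂₃ (C , C∈ , clique , x∈ , y∈ , z∈) = C , C∈ , clique , x∈ , z∈ , y∈

    covered : ∀ {x y z} → IsTriangle H x y z → Covered candidates x y z
    covered {x} {y} {z} t with ≤-total (block x) (block y) | ≤-total (block y) (block z) | ≤-total (block x) (block z)
    ... | inj₁ x≤y | inj₁ y≤z | _        = covered-sorted t x≤y y≤z
    ... | inj₁ x≤y | inj₂ z≤y | inj₁ x≤z =
      Covered-swap₂₃ (covered-sorted (triangle-swap₂₃ t) x≤z z≤y)
    ... | inj₁ x≤y | inj₂ z≤y | inj₂ z≤x =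
      Covered-swap₂₃ (Covered-swap₁₂ (covered-sorted (triangle-swap₁₂ (triangle-swap₂₃ t)) z≤x x≤y))
    ... | inj₂ y≤x | inj₁ y≤z | inj₁ x≤z =
      Covered-swap₁₂ (covered-sorted (triangle-swap₁₂ t) y≤x x≤z)
    ... | inj₂ y≤x | inj₁ y≤z | inj₂ z≤x =
      Covered-swap₁₂ (Covered-swap₂₃ (covered-sorted (triangle-swap₂₃ (triangle-swap₁₂ t)) y≤z z≤x))
    ... | inj₂ y≤x | inj₂ z≤y | _        =
      Covered-swap₁₂ (Covered-swap₂₃ (Covered-swap₁₂
        (covered-sorted (triangle-swap₁₂ (triangle-swap₂₃ (triangle-swap₁₂ t))) z≤y y≤x)))

open import Defs
open import Data.Nat using (ℕ)
open import Data.Integer using (+_; _≤_)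
open import Data.Fin using (Fin)
open import Data.Fin.Subset using (Subset; ∣_∣)
open import Data.List using (List; length)
open import Data.Product using (∃; _×_)

open import Data.Product using (_,_)
open import Data.Integer using (+≤+)
open import Data.Integer.Properties using (module ≤-Reasoning)
import Data.Nat.Properties as ℕ
open import Data.Fin.Subset using (_∈_)
open import Data.List using (filter)
open import Data.List.Properties using (length-filter)
open import Data.List.Relation.Unary.Any using (Any)
open import Data.List.Relation.Unary.All.Properties using (all-filter)
open import Data.List.Membership.Propositional using (lose)
open import Data.List.Membership.Propositional.Properties using (∈-filter⁺)
open TriangleCover using (module NatSums; module Cliques; module CliqueCover)

lemma4p1 : ∀ {n p : ℕ} (H : Graph n) → K5Free H →
           (A : Fin p → Subset n) → IsGreedyPartition H A →
           ∃ λ (𝒞 : List (Subset n)) →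
             Is3CliqueCover H 𝒞 × + length 𝒞 ≤ f (λ i → ∣ A i ∣)
lemma4p1 {n} {p} H K5 A greedy = 𝒞 , (all-filter (isClique? H) candidates , covers) , bound
  where
  open NatSums using (∑)
  open Cliques using (isClique?)
  open CliqueCover H K5 A greedy

  𝒞 : List (Subset n)
  𝒞 = filter (isClique? H) candidates

  covers : ∀ x y z → IsTriangle H x y z → Any (λ C → x ∈ C × y ∈ C × z ∈ C) 𝒞
  covers x y z t with covered t
  ... | C , C∈ , C-clique , x∈y∈z∈ = lose (∈-filter⁺ (isClique? H) C∈ C-clique) x∈y∈z∈

  bound : + length 𝒞 ≤ f (λ i → ∣ A i ∣)
  bound = begin
    + length 𝒞      ≤⟨ +≤+ (ℕ.≤-trans (length-filter (isClique? H) candidates) length-candidates) ⟩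
    + ∑ p increment ≡⟨ f≡∑increment ⟨
    f sizes         ∎
    where open ≤-Reasoning
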